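{- For all expressions $e,f\in\mathsf{Exp}$: if $e\equiv f$ then $e\sim f$, i.e. $e$ and $f$ are bisimilar as states of the \textsf{wGKAT} automaton $(\mathsf{Exp},\partial)$.
   Context: Semiring. Fix a semiring $(\mathbb S,+,\cdot,0,1)$ with $0\neq 1$ which is (i) positive: $x+y=0$ implies $x=y=0$; (ii) refinement: whenever $x+y=z+w$ there exist $s,t,u,v\in\mathbb S$ with $s+t=x$, $s+u=z$, $u+v=y$, $t+v=w$; (iii) Conway: equipped with a map $^*:\mathbb S\to\mathbb S$ such that $(a+b)^*=a^*(ba^*)^*$ and $(ab)^*=1+a(ba)^*b$ for all $a,b$. Syntax. Fix a finite set $T$ of primitive tests, a set $\mathsf{Act}$ of actions and a set $\mathsf{Out}$ of return values. Tests: $b,c::=\mathbf 0\mid\mathbf 1\mid t\in T\mid \bar b\mid b+c\mid bc$ (false, true, negation, disjunction, conjunction); $\equiv_{BA}$ is Boolean equivalence and $\le_{BA}$ entailment. $\mathsf{At}$ is the set of atoms of the Boolean algebra freely generated by $T$; for an atom $\alpha$ and test $b$ exactly one of $\alpha\le_{BA} b$, $\alpha\le_{BA}\bar b$ holds. Expressions: $e,f::=p\in\mathsf{Act}\mid b\mid e+_b f\mid e;f\mid e^{(b)}\mid v\in\mathsf{Out}\mid e\oplus_{r,s}f$ ($r,s\in\mathbb S$), read respectively as action, assertion, if-then-else, sequencing, while loop, return, weighted choice. Scaling: $\odot r:=\mathbf 1\oplus_{r,0}\mathbf 0$. Sequencing binds tighter than choices; $\odot$ binds tightest. Weightings and automata.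 $\mathcal M_\omega(X)$ is the set of finitely supported maps $X\to\mathbb S$, with pointwise sum and scalar multiplication; $\delta_x$ maps $x$ to $1$ and everything else to $0$; $\nu[A]=\sum_{x\in A}\nu(x)$. A \textsf{wGKAT} automaton is $(X,\beta)$ with $\beta:X\to\mathcal M_\omega(2+\mathsf{Out}+\mathsf{Act}\times X)^{\mathsf{At}}$, where $2=\{\checkmark,\times\}$ (accept, reject); write $\beta(x)_\alpha$. Operational semantics $\partial:\mathsf{Exp}\to\mathcal M_\omega(2+\mathsf{Out}+\mathsf{Act}\times\mathsf{Exp})^{\mathsf{At}}$: $\partial(b)_\alpha=\delta_\checkmark$ if $\alpha\le_{BA}b$, else $\delta_\times$; $\partial(v)_\alpha=\delta_v$; $\partial(p)_\alpha=\delta_{(p,\mathbf 1)}$; $\partial(e+_bf)_\alpha=\partial(e)_\alpha$ if $\alpha\le_{BA} b$, else $\partial(f)_\alpha$; $\partial(e\oplus_{r,s}f)_\alpha=r\,\partial(e)_\alpha+s\,\partial(f)_\alpha$; $\partial(e;f)_\alpha=\sum_x\partial(e)_\alpha(x)\,c_{\alpha,f}(x)$ where $c_{\alpha,f}(\checkmark)=\partial(f)_\alpha$, $c_{\alpha,f}(o)=\delta_o$ for $o\in\{\times\}\cup\mathsf{Out}$, $c_{\alpha,f}((p,e'))=\delta_{(p,e';f)}$; $\partial(e^{(b)})_\alpha=\delta_\checkmark$ if $\alpha\le_{BA}\bar b$, and if $\alpha\le_{BA} b$ then $\partial(e^{(b)})_\alpha=\partial(e)_\alpha(\checkmark)^*\big(\sum_{o\in\{\times\}\cup\mathsf{Out}}\partial(e)_\alpha(o)\delta_o+\sum_{(p,e')}\partial(e)_\alpha(p,e')\delta_{(p,e';e^{(b)})}\big)$.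 Bisimilarity. For automata $(X,\beta),(Y,\gamma)$, $h:X\to Y$ is a homomorphism if for all $x,\alpha$: $\gamma(h(x))_\alpha(o)=\beta(x)_\alpha(o)$ for $o\in 2+\mathsf{Out}$ and $\gamma(h(x))_\alpha(p,y)=\beta(x)_\alpha[\{p\}\times h^{ -1}(y)]$. $R\subseteq X\times Y$ is a bisimulation if there is $\rho:R\to\mathcal M_\omega(2+\mathsf{Out}+\mathsf{Act}\times R)^{\mathsf{At}}$ making both projections homomorphisms; $x,y$ are bisimilar if some bisimulation contains $(x,y)$. Axioms. $E:\mathsf{Exp}\to\mathsf{At}\to\mathbb S$: $E(p)_\alpha=E(v)_\alpha=0$; $E(b)_\alpha=1$ if $\alpha\le_{BA} b$ else $0$; $E(e\oplus_{r,s}f)_\alpha=rE(e)_\alpha+sE(f)_\alpha$; $E(e+_bf)_\alpha=E(e)_\alpha$ if $\alpha\le_{BA}b$ else $E(f)_\alpha$; $E(e;f)_\alpha=E(e)_\alpha E(f)_\alpha$; $E(e^{(b)})_\alpha=E(\bar b)_\alpha$. $\equiv$ is the smallest congruence on $\mathsf{Exp}$ (identifying Boolean-equivalent tests) containing all instances ($e,f,g$ expressions, $b,c$ tests, $v\in\mathsf{Out}$, $r,s,t,u\in\mathbb S$) of: (G1) $e+_be\equiv e$; (G2) $e+_bf\equiv b;e+_bf$; (G3) $e+_bf\equiv f+_{\bar b}e$; (G4) $(e+_bf)+_cg\equiv e+_{bc}(f+_cg)$; (D1) $e\oplus_{r,s}(f+_bg)\equiv(e\oplus_{r,s}f)+_b(e\oplus_{r,s}g)$;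 (D2) $e\oplus_{r,s}(f\oplus_{t,u}g)\equiv e\oplus_{r,1}(f\oplus_{st,su}g)$; (D3) $b;(e\oplus_{r,s}f)\equiv b;(b;e\oplus_{r,s}b;f)$; (S1) $\mathbf 1;e\equiv e\equiv e;\mathbf 1$; (S2) $(e;f);g\equiv e;(f;g)$; (S3) $\mathbf 0;e\equiv\mathbf 0$; (S4) $(e\oplus_{r,s}f);g\equiv e;g\oplus_{r,s}f;g$; (S5) $(e+_bf);g\equiv e;g+_bf;g$; (S6) $v;e\equiv v$; (S7) $b;c\equiv bc$; (L1) $e^{(b)}\equiv e;e^{(b)}+_b\mathbf 1$; (C1) $\odot 1\equiv\mathbf 1$; (C2) $\odot 0;e\equiv\odot 0$; (W1) $e\oplus_{r,s}e\equiv\odot(r+s);e$; (W2) $e\oplus_{r,s}f\equiv f\oplus_{s,r}e$; (W3) $e\oplus_{r,s}(f\oplus_{t,u}g)\equiv(e\oplus_{r,st}f)\oplus_{1,su}g$; (W4) $e\oplus_{ru,s}f\equiv(\odot u;e)\oplus_{r,s}f$; and closed under the rules (L2) if $e\equiv(f\oplus_{r,s}\mathbf 1)+_cg$ then $c;e^{(b)}\equiv c;((\odot(s^*r);f;e^{(b)})+_b\mathbf 1)$, and (F1) if $g\equiv e;g+_bf$ and $E(e)_\alpha=0$ for all $\alpha\in\mathsf{At}$ then $g\equiv e^{(b)};f$. -}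

module Defs where

open import Data.Nat using (ℕ)
open import Data.Fin using (Fin)
open import Data.Bool using (Bool; true; false; not; _∧_; _∨_; if_then_else_)
open import Data.List using (List; []; _∷_; _++_; map; concatMap)
open import Data.Product using (Σ; Σ-syntax; _×_; _,_; proj₁; proj₂)
open import Relation.Binary.PropositionalEquality using (_≡_; _≢_)
open import Algebra.Structures using (IsSemiring)

record ConwaySemiring : Set₁ where
  infixl 6 _+_
  infixl 7 _·_
  infix 8 _⋆
  field
    S : Set
    _+_ _·_ : S → S → S
    0# 1# : S
    _⋆ : S → S
    isSemiring : IsSemiring _≡_ _+_ _·_ 0# 1#
    0≢1 : 0# ≢ 1#
    positive : ∀ x y → x + y ≡ 0# → (x ≡ 0#) × (y ≡ 0#)
    refinement : ∀ x y z w → x + y ≡ z + w →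
      Σ[ s ∈ S ] Σ[ t ∈ S ] Σ[ u ∈ S ] Σ[ v ∈ S ]
        (s + t ≡ x) × (s + u ≡ z) × (u + v ≡ y) × (t + v ≡ w)
    conway-sum  : ∀ a b → (a + b) ⋆ ≡ a ⋆ · (b · a ⋆) ⋆
    conway-prod : ∀ a b → (a · b) ⋆ ≡ 1# + a · (b · a) ⋆ · b

-- wGKAT over semiring K, primitive tests T = Fin n, actions Act,
-- return values Out.

module WGKAT (K : ConwaySemiring) (n : ℕ) (Act Out : Set) where
  open ConwaySemiring K

  infix 9 ~_
  infixr 6 _⊹_
  infixr 7 _⊗_
  data Test : Set where
    𝟎 𝟏  : Test
    prim : Fin n → Test
    ~_   : Test → Test
    _⊹_  : Test → Test → Test
    _⊗_  : Test → Test → Test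

  -- Atoms of the free Boolean algebra on T = Fin n, presented as
  -- valuations of the primitive tests.
  At : Set
  At = Fin n → Bool

  ⟦_⟧ : Test → At → Bool
  ⟦ 𝟎 ⟧ α = false
  ⟦ 𝟏 ⟧ α = true
  ⟦ prim t ⟧ α = α t
  ⟦ ~ b ⟧ α = not (⟦ b ⟧ α)
  ⟦ b ⊹ c ⟧ α = ⟦ b ⟧ α ∨ ⟦ c ⟧ α
  ⟦ b ⊗ c ⟧ α = ⟦ b ⟧ α ∧ ⟦ c ⟧ α

  _≤BA_ : At → Test → Set
  α ≤BA b = ⟦ b ⟧ α ≡ true

  _≡BA_ : Test → Test → Set
  b ≡BA c = ∀ α → ⟦ b ⟧ α ≡ ⟦ c ⟧ α

  infixr 8 _⨾_
  infixr 5 _+⟨_⟩_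
  infixr 5 _⊕⟨_,_⟩_
  infix 9 _⁽_⁾
  data Exp : Set where
    act      : Act → Exp
    assert   : Test → Exp
    _+⟨_⟩_   : Exp → Test → Exp → Exp
    _⨾_      : Exp → Exp → Exp
    _⁽_⁾     : Exp → Test → Exp
    ret      : Out → Exp
    _⊕⟨_,_⟩_ : Exp → S → S → Exp → Exp

  ⊙ : S → Exp
  ⊙ r = assert 𝟏 ⊕⟨ r , 0# ⟩ assert 𝟎

  -- Finitely supported weightings M_ω(X), presented as formal finite
  -- sums  Σ wᵢ·xᵢ  (lists of (point, weight)) modulo the equivalence
  -- _≈M_ below; this is exactly the free presentation of the
  -- finitely supported maps X → S (two formal sums are ≈M iff they
  -- determine the same map X → S).

  M : Set → Set
  M X = List (X × S)

  infix 4 _≈M_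
  data _≈M_ {X : Set} : M X → M X → Set where
    ≈refl  : ∀ {l} → l ≈M l
    ≈sym   : ∀ {l l'} → l ≈M l' → l' ≈M l
    ≈trans : ∀ {l l' l''} → l ≈M l' → l' ≈M l'' → l ≈M l''
    ≈cons  : ∀ {x r l l'} → l ≈M l' → ((x , r) ∷ l) ≈M ((x , r) ∷ l')
    ≈swap  : ∀ {x r y s l} → ((x , r) ∷ (y , s) ∷ l) ≈M ((y , s) ∷ (x , r) ∷ l)
    ≈merge : ∀ {x r s l} → ((x , r) ∷ (x , s) ∷ l) ≈M ((x , r + s) ∷ l)
    ≈zero  : ∀ {x l} → ((x , 0#) ∷ l) ≈M l

  δ : {X : Set} → X → M X
  δ x = (x , 1#) ∷ []

  scale : {X : Set} → S → M X → M X
  scale r = map (λ p → (proj₁ p , r · proj₂ p))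

  pushM : {X Y : Set} → (X → Y) → M X → M Y
  pushM f = map (λ p → (f (proj₁ p) , proj₂ p))

  bindM : {X Y : Set} → M X → (X → M Y) → M Y
  bindM l k = concatMap (λ p → scale (proj₂ p) (k (proj₁ p))) l

  data F (X : Set) : Set where
    ✓ ✗  : F X
    out  : Out → F X
    step : Act → X → F X

  mapF : {X Y : Set} → (X → Y) → F X → F Y
  mapF f ✓ = ✓
  mapF f ✗ = ✗
  mapF f (out o) = out o
  mapF f (step p x) = step p (f x)

  coef✓ : {X : Set} → M (F X) → S
  coef✓ [] = 0#
  coef✓ ((✓ , w) ∷ l) = w + coef✓ l
  coef✓ ((✗ , w) ∷ l) = coef✓ l
  coef✓ ((out o , w) ∷ l) = coef✓ l
  coef✓ ((step p x , w) ∷ l) = coef✓ l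

  record Automaton : Set₁ where
    field
      State : Set
      β     : State → At → M (F State)
  open Automaton public

  IsHom : (A B : Automaton) → (State A → State B) → Set
  IsHom A B h = ∀ x α → β B (h x) α ≈M pushM (mapF h) (β A x α)

  RelCarrier : (A B : Automaton) → (State A → State B → Set) → Set
  RelCarrier A B R = Σ[ xy ∈ State A × State B ] R (proj₁ xy) (proj₂ xy)

  IsBisimulation : (A B : Automaton) → (State A → State B → Set) → Set
  IsBisimulation A B R =
    Σ[ ρ ∈ (RelCarrier A B R → At → M (F (RelCarrier A B R))) ]
      (IsHom (record { State = RelCarrier A B R ; β = ρ }) A
             (λ z → proj₁ (proj₁ z))
     × IsHom (record { State = RelCarrier A B R ; β = ρ }) B
             (λ z → proj₂ (proj₁ z)))

  Bisimilar : (A B : Automaton) → State A → State B → Set₁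
  Bisimilar A B x y =
    Σ[ R ∈ (State A → State B → Set) ] (IsBisimulation A B R × R x y)

  seqCont : Exp → M (F Exp) → F Exp → M (F Exp)
  seqCont f df ✓ = df
  seqCont f df ✗ = δ ✗
  seqCont f df (out o) = δ (out o)
  seqCont f df (step p e') = δ (step p (e' ⨾ f))

  -- the non-✓ part of ∂(e)_α, with continuations e' ↦ e' ; g
  loopCont : Exp → F Exp → S → M (F Exp)
  loopCont g ✓ w = []
  loopCont g ✗ w = (✗ , w) ∷ []
  loopCont g (out o) w = (out o , w) ∷ []
  loopCont g (step p e') w = (step p (e' ⨾ g) , w) ∷ []

  ∂ : Exp → At → M (F Exp)
  ∂ (act p) α = δ (step p (assert 𝟏))
  ∂ (assert b) α = if ⟦ b ⟧ α then δ ✓ else δ ✗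
  ∂ (e +⟨ b ⟩ f) α = if ⟦ b ⟧ α then ∂ e α else ∂ f α
  ∂ (e ⨾ f) α = bindM (∂ e α) (seqCont f (∂ f α))
  ∂ (e ⁽ b ⁾) α =
    if ⟦ b ⟧ α
    then scale (coef✓ (∂ e α) ⋆)
               (concatMap (λ p → loopCont (e ⁽ b ⁾) (proj₁ p) (proj₂ p)) (∂ e α))
    else δ ✓
  ∂ (ret v) α = δ (out v)
  ∂ (e ⊕⟨ r , s ⟩ f) α = scale r (∂ e α) ++ scale s (∂ f α)

  ExpAut : Automaton
  ExpAut = record { State = Exp ; β = ∂ }

  infix 4 _∼_
  _∼_ : Exp → Exp → Set₁
  e ∼ f = Bisimilar ExpAut ExpAut e f

  E : Exp → At → S
  E (act p) α = 0#
  E (ret v) α = 0#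
  E (assert b) α = if ⟦ b ⟧ α then 1# else 0#
  E (e ⊕⟨ r , s ⟩ f) α = r · E e α + s · E f α
  E (e +⟨ b ⟩ f) α = if ⟦ b ⟧ α then E e α else E f α
  E (e ⨾ f) α = E e α · E f α
  E (e ⁽ b ⁾) α = E (assert (~ b)) α

  infix 4 _≡ₑ_
  data _≡ₑ_ : Exp → Exp → Set where
    ≡refl  : ∀ {e} → e ≡ₑ e
    ≡sym   : ∀ {e f} → e ≡ₑ f → f ≡ₑ e
    ≡trans : ∀ {e f g} → e ≡ₑ f → f ≡ₑ g → e ≡ₑ g
    cong-ite  : ∀ {e e' f f' b} → e ≡ₑ e' → f ≡ₑ f' → (e +⟨ b ⟩ f) ≡ₑ (e' +⟨ b ⟩ f')
    cong-seq  : ∀ {e e' f f'} → e ≡ₑ e' → f ≡ₑ f' → (e ⨾ f) ≡ₑ (e' ⨾ f')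
    cong-loop : ∀ {e e' b} → e ≡ₑ e' → (e ⁽ b ⁾) ≡ₑ (e' ⁽ b ⁾)
    cong-⊕    : ∀ {e e' f f' r s} → e ≡ₑ e' → f ≡ₑ f' →
                (e ⊕⟨ r , s ⟩ f) ≡ₑ (e' ⊕⟨ r , s ⟩ f')
    BA-test : ∀ {b c} → b ≡BA c → assert b ≡ₑ assert c
    BA-ite  : ∀ {e f b c} → b ≡BA c → (e +⟨ b ⟩ f) ≡ₑ (e +⟨ c ⟩ f)
    BA-loop : ∀ {e b c} → b ≡BA c → (e ⁽ b ⁾) ≡ₑ (e ⁽ c ⁾)
    G1 : ∀ {e b} → (e +⟨ b ⟩ e) ≡ₑ e
    G2 : ∀ {e f b} → (e +⟨ b ⟩ f) ≡ₑ ((assert b ⨾ e) +⟨ b ⟩ f)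
    G3 : ∀ {e f b} → (e +⟨ b ⟩ f) ≡ₑ (f +⟨ ~ b ⟩ e)
    G4 : ∀ {e f g b c} → ((e +⟨ b ⟩ f) +⟨ c ⟩ g) ≡ₑ (e +⟨ b ⊗ c ⟩ (f +⟨ c ⟩ g))
    D1 : ∀ {e f g b r s} →
         (e ⊕⟨ r , s ⟩ (f +⟨ b ⟩ g)) ≡ₑ ((e ⊕⟨ r , s ⟩ f) +⟨ b ⟩ (e ⊕⟨ r , s ⟩ g))
    D2 : ∀ {e f g r s t u} →
         (e ⊕⟨ r , s ⟩ (f ⊕⟨ t , u ⟩ g)) ≡ₑ (e ⊕⟨ r , 1# ⟩ (f ⊕⟨ s · t , s · u ⟩ g))
    D3 : ∀ {e f b r s} →
         (assert b ⨾ (e ⊕⟨ r , s ⟩ f)) ≡ₑ (assert b ⨾ ((assert b ⨾ e) ⊕⟨ r , s ⟩ (assert b ⨾ f)))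
    S1l : ∀ {e} → (assert 𝟏 ⨾ e) ≡ₑ e
    S1r : ∀ {e} → e ≡ₑ (e ⨾ assert 𝟏)
    S2 : ∀ {e f g} → ((e ⨾ f) ⨾ g) ≡ₑ (e ⨾ (f ⨾ g))
    S3 : ∀ {e} → (assert 𝟎 ⨾ e) ≡ₑ assert 𝟎
    S4 : ∀ {e f g r s} → ((e ⊕⟨ r , s ⟩ f) ⨾ g) ≡ₑ ((e ⨾ g) ⊕⟨ r , s ⟩ (f ⨾ g))
    S5 : ∀ {e f g b} → ((e +⟨ b ⟩ f) ⨾ g) ≡ₑ ((e ⨾ g) +⟨ b ⟩ (f ⨾ g))
    S6 : ∀ {v e} → (ret v ⨾ e) ≡ₑ ret v
    S7 : ∀ {b c} → (assert b ⨾ assert c) ≡ₑ assert (b ⊗ c)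
    L1 : ∀ {e b} → (e ⁽ b ⁾) ≡ₑ ((e ⨾ (e ⁽ b ⁾)) +⟨ b ⟩ assert 𝟏)
    C1 : ⊙ 1# ≡ₑ assert 𝟏
    C2 : ∀ {e} → (⊙ 0# ⨾ e) ≡ₑ ⊙ 0#
    W1 : ∀ {e r s} → (e ⊕⟨ r , s ⟩ e) ≡ₑ (⊙ (r + s) ⨾ e)
    W2 : ∀ {e f r s} → (e ⊕⟨ r , s ⟩ f) ≡ₑ (f ⊕⟨ s , r ⟩ e)
    W3 : ∀ {e f g r s t u} →
         (e ⊕⟨ r , s ⟩ (f ⊕⟨ t , u ⟩ g)) ≡ₑ ((e ⊕⟨ r , s · t ⟩ f) ⊕⟨ 1# , s · u ⟩ g)
    W4 : ∀ {e f r s u} → (e ⊕⟨ r · u , s ⟩ f) ≡ₑ ((⊙ u ⨾ e) ⊕⟨ r , s ⟩ f)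
    L2 : ∀ {e f g b c r s} →
         e ≡ₑ ((f ⊕⟨ r , s ⟩ assert 𝟏) +⟨ c ⟩ g) →
         (assert c ⨾ (e ⁽ b ⁾)) ≡ₑ
           (assert c ⨾ ((⊙ (s ⋆ · r) ⨾ (f ⨾ (e ⁽ b ⁾))) +⟨ b ⟩ assert 𝟏))
    F1 : ∀ {e f g b} →
         g ≡ₑ ((e ⨾ g) +⟨ b ⟩ f) →
         (∀ α → E e α ≡ 0#) →
         g ≡ₑ ((e ⁽ b ⁾) ⨾ f)

-- The axiomatic equivalence is itself a bisimulation on (Exp, ∂). For every axiom and
-- rule and every atom α we couple ∂ e α and ∂ f α by a weighting of ≡-related pairs; the
-- congruence and rule cases go through because the continuations e' ↦ e' ; g produced by
-- sequencing and loops respect ≡. The loop axioms need the Conway identities: L1 and L2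
-- unfold a⋆ = 1 + a a⋆ and (s + r k)⋆, and F1 uses 0⋆ = 1. Transitivity is the delicate
-- case: gluing two couplings along their common marginal needs positivity and the
-- refinement property, which make the equations of finitely supported weightings
-- Church–Rosser with respect to splitting weights.

module Submission where

open import Defs
open import Algebra.Structures using (IsSemiring)
open import Data.Bool using (Bool; true; false)
open import Data.List using (List; []; _∷_; _++_; map; concatMap)
import Data.List.Properties as List
open import Data.List.Relation.Unary.All using (All; []; _∷_)
import Data.List.Relation.Unary.All.Properties as All
import Data.List.Relation.Binary.Permutation.Propositional as Perm
open Perm using (_↭_; prep; swap; ↭-refl; ↭-reflexive; ↭-sym; ↭-trans)
import Data.List.Relation.Binary.Permutation.Propositional.Properties as ↭
open import Data.Nat using (ℕ)
open import Data.Product using (Σ-syntax; _×_; _,_; proj₁; proj₂; uncurry)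
open import Function using (_∘_; id)
open import Relation.Binary.PropositionalEquality

module SemiringFacts (K : ConwaySemiring) where
  open ConwaySemiring K
  open IsSemiring isSemiring
    using (+-assoc; +-identityˡ; +-identityʳ; *-assoc; *-identityˡ; *-identityʳ; distribˡ; zeroˡ; zeroʳ)
  open ≡-Reasoning

  ⋆-unfold : ∀ a → a ⋆ ≡ 1# + a · a ⋆
  ⋆-unfold a = begin
    a ⋆                       ≡⟨ cong _⋆ (sym (*-identityʳ a)) ⟩
    (a · 1#) ⋆                ≡⟨ conway-prod a 1# ⟩
    1# + a · (1# · a) ⋆ · 1#  ≡⟨ cong (1# +_) (*-identityʳ _) ⟩
    1# + a · (1# · a) ⋆       ≡⟨ cong (λ x → 1# + a · x ⋆) (*-identityˡ a) ⟩
    1# + a · a ⋆              ∎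

  0⋆≡1 : 0# ⋆ ≡ 1#
  0⋆≡1 = begin
    0# ⋆                       ≡⟨ cong _⋆ (sym (zeroˡ 0#)) ⟩
    (0# · 0#) ⋆                ≡⟨ conway-prod 0# 0# ⟩
    1# + 0# · (0# · 0#) ⋆ · 0# ≡⟨ cong (1# +_) (zeroʳ _) ⟩
    1# + 0#                    ≡⟨ +-identityʳ 1# ⟩
    1#                         ∎

  ⋆-sum-unfold : ∀ s r k → (s + r · k) ⋆ ≡ s ⋆ + ((s ⋆ · r) · k) · (s + r · k) ⋆
  ⋆-sum-unfold s r k = begin
    X                                   ≡⟨ conway-sum s (r · k) ⟩
    s ⋆ · Y ⋆                           ≡⟨ cong (s ⋆ ·_) (⋆-unfold Y) ⟩
    s ⋆ · (1# + Y · Y ⋆)                ≡⟨ distribˡ (s ⋆) 1# (Y · Y ⋆) ⟩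
    s ⋆ · 1# + s ⋆ · (Y · Y ⋆)          ≡⟨ cong₂ _+_ (*-identityʳ (s ⋆)) reassociate ⟩
    s ⋆ + ((s ⋆ · r) · k) · (s ⋆ · Y ⋆) ≡⟨ cong (λ x → s ⋆ + ((s ⋆ · r) · k) · x) (conway-sum s _) ⟨
    s ⋆ + ((s ⋆ · r) · k) · X           ∎
    where
    X = (s + r · k) ⋆
    Y = (r · k) · s ⋆
    reassociate : s ⋆ · (Y · Y ⋆) ≡ ((s ⋆ · r) · k) · (s ⋆ · Y ⋆)
    reassociate = begin
      s ⋆ · (((r · k) · s ⋆) · Y ⋆) ≡⟨ cong (s ⋆ ·_) (*-assoc (r · k) (s ⋆) (Y ⋆)) ⟩
      s ⋆ · ((r · k) · (s ⋆ · Y ⋆)) ≡⟨ sym (*-assoc (s ⋆) (r · k) _) ⟩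
      (s ⋆ · (r · k)) · (s ⋆ · Y ⋆) ≡⟨ cong (_· (s ⋆ · Y ⋆)) (sym (*-assoc (s ⋆) r k)) ⟩
      ((s ⋆ · r) · k) · (s ⋆ · Y ⋆) ∎

  ∑ : List S → S
  ∑ [] = 0#
  ∑ (w ∷ ws) = w + ∑ ws

  ∑-++ : ∀ ws vs → ∑ (ws ++ vs) ≡ ∑ ws + ∑ vs
  ∑-++ [] vs = sym (+-identityˡ _)
  ∑-++ (w ∷ ws) vs = trans (cong (w +_) (∑-++ ws vs)) (sym (+-assoc w _ _))

  Decomposition : S → Set
  Decomposition w = Σ[ vs ∈ List S ] ∑ vs ≡ w

  flatten : ∀ {ws} → All Decomposition ws → List S
  flatten [] = []
  flatten ((vs , _) ∷ ds) = vs ++ flatten ds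

  ∑-flatten : ∀ {ws} (ds : All Decomposition ws) → ∑ (flatten ds) ≡ ∑ ws
  ∑-flatten [] = refl
  ∑-flatten ((vs , ∑vs≡w) ∷ ds) = trans (∑-++ vs _) (cong₂ _+_ ∑vs≡w (∑-flatten ds))

  decompose-zero : ∀ ws → ∑ ws ≡ 0# → Σ[ ds ∈ All Decomposition ws ] flatten ds ≡ []
  decompose-zero [] _ = [] , refl
  decompose-zero (w ∷ ws) eq with positive w (∑ ws) eq
  ... | w≡0 , ∑ws≡0 with decompose-zero ws ∑ws≡0
  ... | ds , flat≡[] = (([] , sym w≡0) ∷ ds) , flat≡[]

  -- The refinement property, iterated along a list.
  refine-row : ∀ a A bs → a + A ≡ ∑ bs →
    Σ[ cs ∈ List (S × S) ] (map (uncurry _+_) cs ≡ bs)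
      × (∑ (map proj₁ cs) ≡ a) × (∑ (map proj₂ cs) ≡ A)
  refine-row a A [] eq with positive a A eq
  ... | a≡0 , A≡0 = [] , refl , sym a≡0 , sym A≡0
  refine-row a A (b ∷ bs) eq with refinement a A b (∑ bs) eq
  ... | s , t , u , v , s+t≡a , s+u≡b , u+v≡A , t+v≡∑bs with refine-row t v bs t+v≡∑bs
  ... | cs , refl , ∑₁≡t , ∑₂≡v =
    ((s , u) ∷ cs) , cong (_∷ _) s+u≡b ,
    trans (cong (s +_) ∑₁≡t) s+t≡a , trans (cong (u +_) ∑₂≡v) u+v≡A

  prefix-column : ∀ (cs : List (S × S)) → All Decomposition (map proj₂ cs) →
    All Decomposition (map (uncurry _+_) cs)
  prefix-column [] [] = []
  prefix-column ((s , _) ∷ cs) ((vs , eq) ∷ ds) = ((s ∷ vs) , cong (s +_) eq) ∷ prefix-column cs ds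

  flatten-prefix-column : ∀ cs ds →
    flatten (prefix-column cs ds) ↭ map proj₁ cs ++ flatten ds
  flatten-prefix-column [] [] = ↭-refl
  flatten-prefix-column ((s , _) ∷ cs) ((vs , _) ∷ ds) =
    prep s (↭-trans (↭.++⁺ˡ vs (flatten-prefix-column cs ds)) (↭.shifts vs (map proj₁ cs)))

  -- A matrix with row sums as and column sums bs, built row by row.
  common-decomposition : ∀ as bs → ∑ as ≡ ∑ bs →
    Σ[ das ∈ All Decomposition as ] Σ[ dbs ∈ All Decomposition bs ] flatten das ↭ flatten dbs
  common-decomposition [] bs eq with decompose-zero bs (sym eq)
  ... | dbs , flat≡[] = [] , dbs , ↭-reflexive (sym flat≡[])
  common-decomposition (a ∷ as) bs eq with refine-row a (∑ as) bs eq
  ... | cs , refl , ∑₁≡a , ∑₂≡∑as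
    with common-decomposition as (map proj₂ cs) (sym ∑₂≡∑as)
  ... | das , dcs , das↭dcs =
    ((map proj₁ cs , ∑₁≡a) ∷ das) , prefix-column cs dcs ,
    ↭-trans (↭.++⁺ˡ (map proj₁ cs) das↭dcs) (↭-sym (flatten-prefix-column cs dcs))

module Soundness (K : ConwaySemiring) (n : ℕ) (Act Out : Set) where
  open ConwaySemiring K
  open IsSemiring isSemiring
    using (+-assoc; +-comm; +-identityˡ; +-identityʳ; *-assoc; *-identityˡ; *-identityʳ;
           distribˡ; distribʳ; zeroˡ; zeroʳ)
  open SemiringFacts K
  open WGKAT K n Act Out
  open ≡-Reasoning

  module _ {X : Set} where
    ≡⇒≈M : {μ ν : M X} → μ ≡ ν → μ ≈M ν
    ≡⇒≈M refl = ≈refl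

    ↭⇒≈M : {μ ν : M X} → μ ↭ ν → μ ≈M ν
    ↭⇒≈M Perm.refl = ≈refl
    ↭⇒≈M (prep _ ρ) = ≈cons (↭⇒≈M ρ)
    ↭⇒≈M (swap _ _ ρ) = ≈trans ≈swap (≈cons (≈cons (↭⇒≈M ρ)))
    ↭⇒≈M (Perm.trans ρ σ) = ≈trans (↭⇒≈M ρ) (↭⇒≈M σ)

    ++-congˡ : ∀ (μ : M X) {ν ν'} → ν ≈M ν' → μ ++ ν ≈M μ ++ ν'
    ++-congˡ [] eq = eq
    ++-congˡ (_ ∷ μ) eq = ≈cons (++-congˡ μ eq)

    ++-congʳ : ∀ {μ μ' : M X} ν → μ ≈M μ' → μ ++ ν ≈M μ' ++ ν
    ++-congʳ ν ≈refl = ≈refl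
    ++-congʳ ν (≈sym eq) = ≈sym (++-congʳ ν eq)
    ++-congʳ ν (≈trans eq eq') = ≈trans (++-congʳ ν eq) (++-congʳ ν eq')
    ++-congʳ ν (≈cons eq) = ≈cons (++-congʳ ν eq)
    ++-congʳ ν ≈swap = ≈swap
    ++-congʳ ν ≈merge = ≈merge
    ++-congʳ ν ≈zero = ≈zero

    ++-cong : ∀ {μ μ' ν ν' : M X} → μ ≈M μ' → ν ≈M ν' → μ ++ ν ≈M μ' ++ ν'
    ++-cong {μ' = μ'} {ν = ν} eq eq' = ≈trans (++-congʳ ν eq) (++-congˡ μ' eq')

    ++-comm-≈M : ∀ (μ ν : M X) → μ ++ ν ≈M ν ++ μ
    ++-comm-≈M μ ν = ↭⇒≈M (↭.++-comm μ ν)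

    ++-shift : ∀ (ν : M X) {μ ξ ζ} → μ ≈M ξ ++ ζ → ν ++ μ ≈M ξ ++ (ν ++ ζ)
    ++-shift ν {ξ = ξ} eq = ≈trans (++-congˡ ν eq) (↭⇒≈M (↭.shifts ν ξ))

    ≈merge′ : ∀ {x : X} {r s t μ} → r + s ≡ t → (x , r) ∷ (x , s) ∷ μ ≈M (x , t) ∷ μ
    ≈merge′ refl = ≈merge

    ≈zero′ : ∀ {x : X} {r μ} → r ≡ 0# → (x , r) ∷ μ ≈M μ
    ≈zero′ refl = ≈zero

    scale-++ : ∀ r (μ ν : M X) → scale r (μ ++ ν) ≡ scale r μ ++ scale r ν
    scale-++ r = List.map-++ _

    scale-scale : ∀ r s (μ : M X) → scale r (scale s μ) ≡ scale (r · s) μ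
    scale-scale r s μ =
      trans (sym (List.map-∘ μ)) (List.map-cong (λ (x , w) → cong (x ,_) (sym (*-assoc r s w))) μ)

    scale-scale-++ : ∀ s t u (μ ν : M X) →
      scale s (scale t μ ++ scale u ν) ≡ scale (s · t) μ ++ scale (s · u) ν
    scale-scale-++ s t u μ ν =
      trans (scale-++ s (scale t μ) _) (cong₂ _++_ (scale-scale s t μ) (scale-scale s u ν))

    scale-1 : ∀ (μ : M X) → scale 1# μ ≡ μ
    scale-1 μ = trans (List.map-cong (λ (x , w) → cong (x ,_) (*-identityˡ w)) μ) (List.map-id μ)

    scale-cong : ∀ r {μ ν : M X} → μ ≈M ν → scale r μ ≈M scale r ν
    scale-cong r ≈refl = ≈refl
    scale-cong r (≈sym eq) = ≈sym (scale-cong r eq)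
    scale-cong r (≈trans eq eq') = ≈trans (scale-cong r eq) (scale-cong r eq')
    scale-cong r (≈cons eq) = ≈cons (scale-cong r eq)
    scale-cong r ≈swap = ≈swap
    scale-cong r (≈merge {r = a} {s = b}) = ≈merge′ (sym (distribˡ r a b))
    scale-cong r ≈zero = ≈zero′ (zeroʳ r)

    scale-0 : ∀ (μ : M X) → scale 0# μ ≈M []
    scale-0 [] = ≈refl
    scale-0 ((x , w) ∷ μ) = ≈trans (≈zero′ (zeroˡ w)) (scale-0 μ)

    scale-+ : ∀ r s (μ : M X) → scale r μ ++ scale s μ ≈M scale (r + s) μ
    scale-+ r s [] = ≈refl
    scale-+ r s ((x , w) ∷ μ) =
      ≈trans (≈cons (↭⇒≈M (↭.shift (x , s · w) (scale r μ) (scale s μ))))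
        (≈trans (≈merge′ (sym (distribʳ w r s))) (≈cons (scale-+ r s μ)))

    ⋆-scale-unfold : ∀ c (μ : M X) → scale c (scale (c ⋆) μ) ++ μ ≈M scale (c ⋆) μ
    ⋆-scale-unfold c μ =
      ≈trans (≡⇒≈M (cong₂ _++_ (scale-scale c (c ⋆) μ) (sym (scale-1 μ))))
        (≈trans (++-comm-≈M (scale (c · c ⋆) μ) (scale 1# μ))
          (≈trans (scale-+ 1# (c · c ⋆) μ) (≡⇒≈M (cong (λ x → scale x μ) (sym (⋆-unfold c))))))

  module _ {X Y : Set} where
    push-cong : ∀ (f : X → Y) {μ ν} → μ ≈M ν → pushM f μ ≈M pushM f ν
    push-cong f ≈refl = ≈refl
    push-cong f (≈sym eq) = ≈sym (push-cong f eq)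
    push-cong f (≈trans eq eq') = ≈trans (push-cong f eq) (push-cong f eq')
    push-cong f (≈cons eq) = ≈cons (push-cong f eq)
    push-cong f ≈swap = ≈swap
    push-cong f ≈merge = ≈merge
    push-cong f ≈zero = ≈zero

    push-++ : ∀ (f : X → Y) μ ν → pushM f (μ ++ ν) ≡ pushM f μ ++ pushM f ν
    push-++ f = List.map-++ _

    push-scale : ∀ (f : X → Y) r μ → pushM f (scale r μ) ≡ scale r (pushM f μ)
    push-scale f r μ = trans (sym (List.map-∘ μ)) (List.map-∘ μ)

    push-ext : ∀ {f g : X → Y} → (∀ x → f x ≡ g x) → ∀ μ → pushM f μ ≡ pushM g μ
    push-ext f≗g = List.map-cong (λ (x , w) → cong (_, w) (f≗g x))

    bind-++ : ∀ (μ ν : M X) (k : X → M Y) → bindM (μ ++ ν) k ≡ bindM μ k ++ bindM ν k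
    bind-++ [] ν k = refl
    bind-++ ((x , w) ∷ μ) ν k =
      trans (cong (scale w (k x) ++_) (bind-++ μ ν k)) (sym (List.++-assoc (scale w (k x)) _ _))

    bind-scale : ∀ r (μ : M X) (k : X → M Y) → bindM (scale r μ) k ≡ scale r (bindM μ k)
    bind-scale r [] k = refl
    bind-scale r ((x , w) ∷ μ) k =
      trans (cong₂ _++_ (sym (scale-scale r w (k x))) (bind-scale r μ k))
        (sym (scale-++ r (scale w (k x)) _))

    bind-cong : ∀ {μ ν : M X} (k : X → M Y) → μ ≈M ν → bindM μ k ≈M bindM ν k
    bind-cong k ≈refl = ≈refl
    bind-cong k (≈sym eq) = ≈sym (bind-cong k eq)
    bind-cong k (≈trans eq eq') = ≈trans (bind-cong k eq) (bind-cong k eq')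
    bind-cong k (≈cons {x = x} {r = r} eq) = ++-congˡ (scale r (k x)) (bind-cong k eq)
    bind-cong k (≈swap {x = x} {r = r} {y = y} {s = s}) =
      ↭⇒≈M (↭.shifts (scale r (k x)) (scale s (k y)))
    bind-cong k (≈merge {x = x} {r = r} {s = s}) =
      ≈trans (≡⇒≈M (sym (List.++-assoc (scale r (k x)) (scale s (k x)) _)))
        (++-congʳ _ (scale-+ r s (k x)))
    bind-cong k (≈zero {x = x} {l = μ}) = ++-congʳ (bindM μ k) (scale-0 (k x))

    bind-congʳ : ∀ (μ : M X) {k k' : X → M Y} → (∀ x → k x ≈M k' x) →
      bindM μ k ≈M bindM μ k'
    bind-congʳ [] k≈k' = ≈refl
    bind-congʳ ((x , w) ∷ μ) k≈k' = ++-cong (scale-cong w (k≈k' x)) (bind-congʳ μ k≈k')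

    bind-ext : ∀ (μ : M X) {k k' : X → M Y} → (∀ x → k x ≡ k' x) → bindM μ k ≡ bindM μ k'
    bind-ext μ k≗k' = List.concatMap-cong (λ (x , w) → cong (scale w) (k≗k' x)) μ

    δ-bind : ∀ (x : X) (k : X → M Y) → bindM (δ x) k ≈M k x
    δ-bind x k = ≡⇒≈M (trans (List.++-identityʳ _) (scale-1 (k x)))

    bind-δ : ∀ (μ : M X) (f : X → Y) → bindM μ (δ ∘ f) ≡ pushM f μ
    bind-δ [] f = refl
    bind-δ ((x , w) ∷ μ) f = cong₂ _∷_ (cong (f x ,_) (*-identityʳ w)) (bind-δ μ f)

  module _ {X Y Z : Set} where
    push-push : ∀ (f : X → Y) (g : Y → Z) μ → pushM g (pushM f μ) ≡ pushM (g ∘ f) μ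
    push-push f g μ = sym (List.map-∘ μ)

    push-bind : ∀ (h : Y → Z) (μ : M X) (k : X → M Y) →
      pushM h (bindM μ k) ≡ bindM μ (pushM h ∘ k)
    push-bind h [] k = refl
    push-bind h ((x , w) ∷ μ) k =
      trans (push-++ h (scale w (k x)) _) (cong₂ _++_ (push-scale h w (k x)) (push-bind h μ k))

    bind-push : ∀ (f : X → Y) (μ : M X) (k : Y → M Z) → bindM (pushM f μ) k ≡ bindM μ (k ∘ f)
    bind-push f [] k = refl
    bind-push f ((x , w) ∷ μ) k = cong (scale w (k (f x)) ++_) (bind-push f μ k)

    bind-assoc : ∀ (μ : M X) (k : X → M Y) (k' : Y → M Z) →
      bindM (bindM μ k) k' ≡ bindM μ (λ x → bindM (k x) k')
    bind-assoc [] k k' = refl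
    bind-assoc ((x , w) ∷ μ) k k' =
      trans (bind-++ (scale w (k x)) _ k') (cong₂ _++_ (bind-scale w (k x) k') (bind-assoc μ k k'))

  coef-++ : ∀ {X} (μ ν : M (F X)) → coef✓ (μ ++ ν) ≡ coef✓ μ + coef✓ ν
  coef-++ [] ν = sym (+-identityˡ _)
  coef-++ ((✓ , w) ∷ μ) ν = trans (cong (w +_) (coef-++ μ ν)) (sym (+-assoc w _ _))
  coef-++ ((✗ , _) ∷ μ) ν = coef-++ μ ν
  coef-++ ((out _ , _) ∷ μ) ν = coef-++ μ ν
  coef-++ ((step _ _ , _) ∷ μ) ν = coef-++ μ ν

  coef-scale : ∀ {X} r (μ : M (F X)) → coef✓ (scale r μ) ≡ r · coef✓ μ
  coef-scale r [] = sym (zeroʳ r)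
  coef-scale r ((✓ , w) ∷ μ) = trans (cong (r · w +_) (coef-scale r μ)) (sym (distribˡ r w _))
  coef-scale r ((✗ , _) ∷ μ) = coef-scale r μ
  coef-scale r ((out _ , _) ∷ μ) = coef-scale r μ
  coef-scale r ((step _ _ , _) ∷ μ) = coef-scale r μ

  coef-push : ∀ {X Y} (f : X → Y) (μ : M (F X)) → coef✓ (pushM (mapF f) μ) ≡ coef✓ μ
  coef-push f [] = refl
  coef-push f ((✓ , w) ∷ μ) = cong (w +_) (coef-push f μ)
  coef-push f ((✗ , _) ∷ μ) = coef-push f μ
  coef-push f ((out _ , _) ∷ μ) = coef-push f μ
  coef-push f ((step _ _ , _) ∷ μ) = coef-push f μ

  weight✓ : ∀ {X} → F X → S → S
  weight✓ ✓ w = w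
  weight✓ ✗ _ = 0#
  weight✓ (out _) _ = 0#
  weight✓ (step _ _) _ = 0#

  coef-∷ : ∀ {X} (x : F X) w μ → coef✓ ((x , w) ∷ μ) ≡ weight✓ x w + coef✓ μ
  coef-∷ ✓ w μ = refl
  coef-∷ ✗ w μ = sym (+-identityˡ _)
  coef-∷ (out _) w μ = sym (+-identityˡ _)
  coef-∷ (step _ _) w μ = sym (+-identityˡ _)

  weight✓-+ : ∀ {X} (x : F X) r s → weight✓ x r + weight✓ x s ≡ weight✓ x (r + s)
  weight✓-+ ✓ r s = refl
  weight✓-+ ✗ r s = +-identityˡ 0#
  weight✓-+ (out _) r s = +-identityˡ 0#
  weight✓-+ (step _ _) r s = +-identityˡ 0#

  weight✓-0 : ∀ {X} (x : F X) → weight✓ x 0# ≡ 0#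
  weight✓-0 ✓ = refl
  weight✓-0 ✗ = refl
  weight✓-0 (out _) = refl
  weight✓-0 (step _ _) = refl

  coef-∷∷ : ∀ {X} (x y : F X) r s μ →
    coef✓ ((x , r) ∷ (y , s) ∷ μ) ≡ weight✓ x r + (weight✓ y s + coef✓ μ)
  coef-∷∷ x y r s μ = trans (coef-∷ x r _) (cong (weight✓ x r +_) (coef-∷ y s μ))

  coef-cong : ∀ {X} {μ ν : M (F X)} → μ ≈M ν → coef✓ μ ≡ coef✓ ν
  coef-cong ≈refl = refl
  coef-cong (≈sym eq) = sym (coef-cong eq)
  coef-cong (≈trans eq eq') = trans (coef-cong eq) (coef-cong eq')
  coef-cong (≈cons {x = x} {r = r} {l = μ} {l' = ν} eq) = begin
    coef✓ ((x , r) ∷ μ)     ≡⟨ coef-∷ x r μ ⟩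
    weight✓ x r + coef✓ μ   ≡⟨ cong (weight✓ x r +_) (coef-cong eq) ⟩
    weight✓ x r + coef✓ ν   ≡⟨ coef-∷ x r ν ⟨
    coef✓ ((x , r) ∷ ν)     ∎
  coef-cong (≈swap {x = x} {r = r} {y = y} {s = s} {l = μ}) = begin
    coef✓ ((x , r) ∷ (y , s) ∷ μ)          ≡⟨ coef-∷∷ x y r s μ ⟩
    weight✓ x r + (weight✓ y s + coef✓ μ)  ≡⟨ +-assoc (weight✓ x r) _ _ ⟨
    (weight✓ x r + weight✓ y s) + coef✓ μ  ≡⟨ cong (_+ coef✓ μ) (+-comm (weight✓ x r) _) ⟩
    (weight✓ y s + weight✓ x r) + coef✓ μ  ≡⟨ +-assoc (weight✓ y s) _ _ ⟩
    weight✓ y s + (weight✓ x r + coef✓ μ)  ≡⟨ coef-∷∷ y x s r μ ⟨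
    coef✓ ((y , s) ∷ (x , r) ∷ μ)          ∎
  coef-cong (≈merge {x = x} {r = r} {s = s} {l = μ}) = begin
    coef✓ ((x , r) ∷ (x , s) ∷ μ)          ≡⟨ coef-∷∷ x x r s μ ⟩
    weight✓ x r + (weight✓ x s + coef✓ μ)  ≡⟨ +-assoc (weight✓ x r) _ _ ⟨
    (weight✓ x r + weight✓ x s) + coef✓ μ  ≡⟨ cong (_+ coef✓ μ) (weight✓-+ x r s) ⟩
    weight✓ x (r + s) + coef✓ μ            ≡⟨ coef-∷ x (r + s) μ ⟨
    coef✓ ((x , r + s) ∷ μ)                ∎
  coef-cong (≈zero {x = x} {l = μ}) = begin
    coef✓ ((x , 0#) ∷ μ)    ≡⟨ coef-∷ x 0# μ ⟩
    weight✓ x 0# + coef✓ μ  ≡⟨ cong (_+ coef✓ μ) (weight✓-0 x) ⟩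
    0# + coef✓ μ            ≡⟨ +-identityˡ _ ⟩
    coef✓ μ                 ∎

  mapF-∘ : ∀ {X Y Z} {g : X → Y} {h : Y → Z} {k : X → Z} → (∀ x → h (g x) ≡ k x) →
    ∀ y → mapF h (mapF g y) ≡ mapF k y
  mapF-∘ hg≗k ✓ = refl
  mapF-∘ hg≗k ✗ = refl
  mapF-∘ hg≗k (out _) = refl
  mapF-∘ hg≗k (step p x) = cong (step p) (hg≗k x)

  push-mapF-∘ : ∀ {X Y Z} {g : X → Y} {h : Y → Z} {k : X → Z} → (∀ x → h (g x) ≡ k x) →
    ∀ μ → pushM (mapF h) (pushM (mapF g) μ) ≡ pushM (mapF k) μ
  push-mapF-∘ {g = g} {h} hg≗k μ = trans (push-push (mapF g) (mapF h) μ) (push-ext (mapF-∘ hg≗k) μ)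

  push-mapF-id : ∀ {X} (μ : M (F X)) → pushM (mapF id) μ ≡ μ
  push-mapF-id μ = trans (push-ext mapF-id μ) (List.map-id μ)
    where
    mapF-id : ∀ y → mapF id y ≡ y
    mapF-id ✓ = refl
    mapF-id ✗ = refl
    mapF-id (out _) = refl
    mapF-id (step _ _) = refl

  -- Church–Rosser property of ≈M

  module _ {X : Set} where
    Splitting : M X → Set
    Splitting = All (Decomposition ∘ proj₂)

    pieces : X → List S → M X
    pieces x = map (x ,_)

    split : (μ : M X) → Splitting μ → M X
    split [] [] = []
    split ((x , _) ∷ μ) ((ws , _) ∷ d) = pieces x ws ++ split μ d

    infix 4 _◁_
    _◁_ : M X → M X → Set
    μ ◁ ν = Σ[ d ∈ Splitting μ ] split μ d ↭ ν

    pieces-≈M : ∀ x ws (ν : M X) → pieces x ws ++ ν ≈M (x , ∑ ws) ∷ ν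
    pieces-≈M x [] ν = ≈sym ≈zero
    pieces-≈M x (w ∷ ws) ν = ≈trans (≈cons (pieces-≈M x ws ν)) ≈merge

    split-≈M : ∀ μ (d : Splitting μ) → split μ d ≈M μ
    split-≈M [] [] = ≈refl
    split-≈M ((x , _) ∷ μ) ((ws , refl) ∷ d) =
      ≈trans (++-congˡ (pieces x ws) (split-≈M μ d)) (pieces-≈M x ws μ)

    ◁⇒≈M : ∀ {μ ν} → μ ◁ ν → ν ≈M μ
    ◁⇒≈M {μ} (d , ρ) = ≈trans (≈sym (↭⇒≈M ρ)) (split-≈M μ d)

    unsplit : ∀ μ → Σ[ d ∈ Splitting μ ] split μ d ≡ μ
    unsplit [] = [] , refl
    unsplit ((x , r) ∷ μ) with unsplit μ
    ... | d , eq = (((r ∷ []) , +-identityʳ r) ∷ d) , cong ((x , r) ∷_) eq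

    ◁-refl : ∀ μ → μ ◁ μ
    ◁-refl μ = proj₁ (unsplit μ) , ↭-reflexive (proj₂ (unsplit μ))

    ◁-↭ : ∀ {μ ν ν'} → μ ◁ ν → ν ↭ ν' → μ ◁ ν'
    ◁-↭ (d , ρ) σ = d , ↭-trans ρ σ

    ◁-cons : ∀ {μ ν} (x : X) r → μ ◁ ν → (x , r) ∷ μ ◁ (x , r) ∷ ν
    ◁-cons x r (d , ρ) = (((r ∷ []) , +-identityʳ r) ∷ d) , prep (x , r) ρ

    split-++⁺ : ∀ μ {ν} (d : Splitting μ) (d' : Splitting ν) →
      split (μ ++ ν) (All.++⁺ d d') ≡ split μ d ++ split ν d'
    split-++⁺ [] [] d' = refl
    split-++⁺ ((x , _) ∷ μ) ((ws , _) ∷ d) d' =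
      trans (cong (pieces x ws ++_) (split-++⁺ μ d d')) (sym (List.++-assoc (pieces x ws) _ _))

    split-++⁻ : ∀ μ {ν} (d : Splitting (μ ++ ν)) →
      split (μ ++ ν) d ≡ split μ (proj₁ (All.++⁻ μ d)) ++ split ν (proj₂ (All.++⁻ μ d))
    split-++⁻ [] d = refl
    split-++⁻ ((x , _) ∷ μ) ((ws , _) ∷ d) =
      trans (cong (pieces x ws ++_) (split-++⁻ μ d)) (sym (List.++-assoc (pieces x ws) _ _))

    split-pieces⁺ : ∀ x {ws} (ds : All Decomposition ws) →
      split (pieces x ws) (All.map⁺ ds) ≡ pieces x (flatten ds)
    split-pieces⁺ x [] = refl
    split-pieces⁺ x ((vs , _) ∷ ds) =
      trans (cong (pieces x vs ++_) (split-pieces⁺ x ds)) (sym (List.map-++ _ vs _))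

    split-pieces⁻ : ∀ x ws (d : Splitting (pieces x ws)) →
      split (pieces x ws) d ≡ pieces x (flatten (All.map⁻ d))
    split-pieces⁻ x [] [] = refl
    split-pieces⁻ x (_ ∷ ws) ((vs , _) ∷ d) =
      trans (cong (pieces x vs ++_) (split-pieces⁻ x ws d)) (sym (List.map-++ _ vs _))

    split-↭ : ∀ {μ μ'} → μ ↭ μ' → (d : Splitting μ) →
      Σ[ d' ∈ Splitting μ' ] split μ d ↭ split μ' d'
    split-↭ Perm.refl d = d , ↭-refl
    split-↭ (prep (x , _) ρ) ((ws , eq) ∷ d) with split-↭ ρ d
    ... | d' , σ = ((ws , eq) ∷ d') , ↭.++⁺ˡ (pieces x ws) σ
    split-↭ (swap (x , _) (y , _) ρ) ((ws , eq) ∷ (vs , eq') ∷ d) with split-↭ ρ d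
    ... | d' , σ = ((vs , eq') ∷ (ws , eq) ∷ d') ,
      ↭-trans (↭.shifts (pieces x ws) (pieces y vs))
        (↭.++⁺ˡ (pieces y vs) (↭.++⁺ˡ (pieces x ws) σ))
    split-↭ (Perm.trans ρ ρ') d with split-↭ ρ d
    ... | d' , σ with split-↭ ρ' d'
    ... | d'' , σ' = d'' , ↭-trans σ σ'

    split-split : ∀ μ (d : Splitting μ) (d' : Splitting (split μ d)) →
      Σ[ d'' ∈ Splitting μ ] split μ d'' ≡ split (split μ d) d'
    split-split [] [] [] = [] , refl
    split-split ((x , _) ∷ μ) ((ws , ∑ws≡r) ∷ d) d'
      with All.++⁻ (pieces x ws) d' | split-++⁻ (pieces x ws) d'
    ... | dx , dμ | eq with split-split μ d dμ
    ... | d'' , eq'' =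
      ((flatten (All.map⁻ dx) , trans (∑-flatten (All.map⁻ dx)) ∑ws≡r) ∷ d'') ,
      trans (cong₂ _++_ (sym (split-pieces⁻ x ws dx)) eq'') (sym eq)

    ◁-trans : ∀ {μ ν ξ} → μ ◁ ν → ν ◁ ξ → μ ◁ ξ
    ◁-trans {μ} (d , ρ) (e , σ) with split-↭ (↭-sym ρ) e
    ... | e' , ρ' with split-split μ d e'
    ... | d'' , eq = d'' , ↭-trans (↭-reflexive eq) (↭-trans (↭-sym ρ') σ)

    split-diamond : ∀ μ (d₁ d₂ : Splitting μ) →
      Σ[ e₁ ∈ Splitting (split μ d₁) ] Σ[ e₂ ∈ Splitting (split μ d₂) ]
        split (split μ d₁) e₁ ↭ split (split μ d₂) e₂
    split-diamond [] [] [] = [] , [] , ↭-refl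
    split-diamond ((x , _) ∷ μ) ((ws₁ , eq₁) ∷ d₁) ((ws₂ , eq₂) ∷ d₂)
      with common-decomposition ws₁ ws₂ (trans eq₁ (sym eq₂)) | split-diamond μ d₁ d₂
    ... | ds₁ , ds₂ , ρ | e₁ , e₂ , σ =
      All.++⁺ (All.map⁺ ds₁) e₁ , All.++⁺ (All.map⁺ ds₂) e₂ ,
      ↭-trans (↭-reflexive (split-row ws₁ ds₁ e₁))
        (↭-trans (↭.++⁺ (↭.map⁺ _ ρ) σ) (↭-sym (↭-reflexive (split-row ws₂ ds₂ e₂))))
      where
      split-row : ∀ ws (ds : All Decomposition ws) {ν} (e : Splitting ν) →
        split (pieces x ws ++ ν) (All.++⁺ (All.map⁺ ds) e) ≡ pieces x (flatten ds) ++ split ν e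
      split-row ws ds e =
        trans (split-++⁺ (pieces x ws) (All.map⁺ ds) e) (cong (_++ _) (split-pieces⁺ x ds))

    ◁-confluent : ∀ {μ ν₁ ν₂} → μ ◁ ν₁ → μ ◁ ν₂ → Σ[ ξ ∈ M X ] (ν₁ ◁ ξ) × (ν₂ ◁ ξ)
    ◁-confluent {μ} (d₁ , ρ₁) (d₂ , ρ₂) with split-diamond μ d₁ d₂
    ... | e₁ , e₂ , σ with split-↭ ρ₁ e₁ | split-↭ ρ₂ e₂
    ... | e₁' , σ₁ | e₂' , σ₂ =
      split (split μ d₁) e₁ , (e₁' , ↭-sym σ₁) , (e₂' , ↭-trans (↭-sym σ₂) (↭-sym σ))

    ≈M⇒common-refinement : ∀ {μ ν : M X} → μ ≈M ν → Σ[ ξ ∈ M X ] (μ ◁ ξ) × (ν ◁ ξ)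
    ≈M⇒common-refinement {μ} ≈refl = μ , ◁-refl μ , ◁-refl μ
    ≈M⇒common-refinement (≈sym eq) with ≈M⇒common-refinement eq
    ... | ξ , μ◁ξ , ν◁ξ = ξ , ν◁ξ , μ◁ξ
    ≈M⇒common-refinement (≈trans eq eq') with ≈M⇒common-refinement eq | ≈M⇒common-refinement eq'
    ... | ξ₁ , μ◁ξ₁ , ν◁ξ₁ | ξ₂ , ν◁ξ₂ , ν'◁ξ₂ with ◁-confluent ν◁ξ₁ ν◁ξ₂
    ... | ξ , ξ₁◁ξ , ξ₂◁ξ = ξ , ◁-trans μ◁ξ₁ ξ₁◁ξ , ◁-trans ν'◁ξ₂ ξ₂◁ξ
    ≈M⇒common-refinement (≈cons {x = x} {r = r} eq) with ≈M⇒common-refinement eq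
    ... | ξ , μ◁ξ , ν◁ξ = _ , ◁-cons x r μ◁ξ , ◁-cons x r ν◁ξ
    ≈M⇒common-refinement (≈swap {x = x} {r = r} {y = y} {s = s}) =
      _ , ◁-refl _ , ◁-↭ (◁-refl _) (swap (y , s) (x , r) ↭-refl)
    ≈M⇒common-refinement (≈merge {x = x} {r = r} {s = s} {l = μ}) =
      _ , ◁-refl _ ,
      ((((r ∷ s ∷ []) , cong (r +_) (+-identityʳ s)) ∷ proj₁ (unsplit μ)) ,
       prep _ (prep _ (↭-reflexive (proj₂ (unsplit μ)))))
    ≈M⇒common-refinement (≈zero {l = μ}) =
      μ , ((([] , refl) ∷ proj₁ (unsplit μ)) , ↭-reflexive (proj₂ (unsplit μ))) , ◁-refl μ

  module _ {X Y : Set} (f : X → Y) where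
    push-split : ∀ μ (d : Splitting (pushM f μ)) →
      pushM f (split μ (All.map⁻ d)) ≡ split (pushM f μ) d
    push-split [] [] = refl
    push-split ((x , _) ∷ μ) ((ws , _) ∷ d) =
      trans (push-++ f (pieces x ws) _)
        (cong₂ _++_ (sym (List.map-∘ ws)) (push-split μ d))

    ◁-push⁻ : ∀ {μ ν} → pushM f μ ◁ ν → Σ[ μ' ∈ M X ] (μ ◁ μ') × (pushM f μ' ≡ ν)
    ◁-push⁻ {μ} (d , ρ) with ↭.↭-map-inv _ (↭-trans (↭-reflexive (push-split μ d)) ρ)
    ... | μ' , ν≡fμ' , σ = μ' , (All.map⁻ d , σ) , sym ν≡fμ'

  -- Lifting relations to weightings

  Graph : {X Y : Set} → (X → Y → Set) → Set
  Graph {X} {Y} R = Σ[ xy ∈ X × Y ] R (proj₁ xy) (proj₂ xy)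

  module _ {X Y : Set} {R : X → Y → Set} where
    outl : Graph R → X
    outl = proj₁ ∘ proj₁

    outr : Graph R → Y
    outr = proj₂ ∘ proj₁

  Lift : {X Y : Set} → (X → Y → Set) → M (F X) → M (F Y) → Set
  Lift R μ ν = Σ[ c ∈ M (F (Graph R)) ] (μ ≈M pushM (mapF outl) c) × (ν ≈M pushM (mapF outr) c)

  module _ {X Y : Set} {R : X → Y → Set} where
    Lift-≈ˡ : ∀ {μ μ' ν} → μ ≈M μ' → Lift R μ' ν → Lift R μ ν
    Lift-≈ˡ eq (c , l , r) = c , ≈trans eq l , r

    Lift-≈ʳ : ∀ {μ ν ν'} → ν ≈M ν' → Lift R μ ν' → Lift R μ ν
    Lift-≈ʳ eq (c , l , r) = c , l , ≈trans eq r

    Lift-++ : ∀ {μ ν μ' ν'} → Lift R μ ν → Lift R μ' ν' → Lift R (μ ++ μ') (ν ++ ν')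
    Lift-++ (c , l , r) (c' , l' , r') = c ++ c' ,
      ≈trans (++-cong l l') (≡⇒≈M (sym (push-++ _ c c'))) ,
      ≈trans (++-cong r r') (≡⇒≈M (sym (push-++ _ c c')))

    Lift-scale : ∀ s {μ ν} → Lift R μ ν → Lift R (scale s μ) (scale s ν)
    Lift-scale s (c , l , r) = scale s c ,
      ≈trans (scale-cong s l) (≡⇒≈M (sym (push-scale _ s c))) ,
      ≈trans (scale-cong s r) (≡⇒≈M (sym (push-scale _ s c)))

    Lift-coef : ∀ {μ ν} → Lift R μ ν → coef✓ μ ≡ coef✓ ν
    Lift-coef (c , l , r) =
      trans (coef-cong l) (trans (coef-push outl c) (sym (trans (coef-cong r) (coef-push outr c))))

  Lift-refl : ∀ {X} {R : X → X → Set} → (∀ x → R x x) → ∀ μ → Lift R μ μ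
  Lift-refl {X} {R} R-refl μ =
    pushM (mapF diagonal) μ , retract outl (λ _ → refl) , retract outr (λ _ → refl)
    where
    diagonal : X → Graph R
    diagonal x = (x , x) , R-refl x
    retract : (π : Graph R → X) → (∀ x → π (diagonal x) ≡ x) →
      μ ≈M pushM (mapF π) (pushM (mapF diagonal) μ)
    retract π π∘diagonal≗id =
      ≡⇒≈M (sym (trans (push-mapF-∘ π∘diagonal≗id μ) (push-mapF-id μ)))

  Lift-sym : ∀ {X Y} {R : X → Y → Set} {R' : Y → X → Set} → (∀ {x y} → R x y → R' y x) →
    ∀ {μ ν} → Lift R μ ν → Lift R' ν μ
  Lift-sym {R = R} {R'} R⇒R' (c , l , r) = pushM (mapF transpose) c ,
    ≈trans r (≡⇒≈M (sym (push-mapF-∘ (λ _ → refl) c))) ,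
    ≈trans l (≡⇒≈M (sym (push-mapF-∘ (λ _ → refl) c)))
    where
    transpose : Graph R → Graph R'
    transpose ((x , y) , xRy) = (y , x) , R⇒R' xRy

  module _ {X Y Z : Set} {R₁ : X → Y → Set} {R₂ : Y → Z → Set} {R₃ : X → Z → Set}
    (compose : ∀ {x y z} → R₁ x y → R₂ y z → R₃ x z) where

    glue : (a : F (Graph R₁)) (b : F (Graph R₂)) → mapF outr a ≡ mapF outl b →
      Σ[ g ∈ F (Graph R₃) ] (mapF outl g ≡ mapF outl a) × (mapF outr g ≡ mapF outr b)
    glue ✓ ✓ _ = ✓ , refl , refl
    glue ✗ ✗ _ = ✗ , refl , refl
    glue (out o) (out .o) refl = out o , refl , refl
    glue (step p ((x , y) , xRy)) (step .p ((.y , z) , yRz)) refl =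
      step p ((x , z) , compose xRy yRz) , refl , refl
    glue ✓ ✗ ()
    glue ✓ (out _) ()
    glue ✓ (step _ _) ()
    glue ✗ ✓ ()
    glue ✗ (out _) ()
    glue ✗ (step _ _) ()
    glue (out _) ✓ ()
    glue (out _) ✗ ()
    glue (out _) (step _ _) ()
    glue (step _ _) ✓ ()
    glue (step _ _) ✗ ()
    glue (step _ _) (out _) ()

    glue-couplings : (c₁ : M (F (Graph R₁))) (c₂ : M (F (Graph R₂))) →
      pushM (mapF outr) c₁ ≡ pushM (mapF outl) c₂ →
      Σ[ c ∈ M (F (Graph R₃)) ]
        (pushM (mapF outl) c ≡ pushM (mapF outl) c₁) × (pushM (mapF outr) c ≡ pushM (mapF outr) c₂)
    glue-couplings [] [] _ = [] , refl , refl
    glue-couplings ((a , w) ∷ c₁) ((b , _) ∷ c₂) eq with List.∷-injective eq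
    ... | head , tail with glue a b (cong proj₁ head) | glue-couplings c₁ c₂ tail
    ... | g , ga , gb | c , c≡ˡ , c≡ʳ =
      ((g , w) ∷ c) ,
      cong₂ _∷_ (cong (_, w) ga) c≡ˡ , cong₂ _∷_ (cong₂ _,_ gb (cong proj₂ head)) c≡ʳ

    -- The two middle marginals agree only up to ≈M; refining both couplings to a common
    -- refinement of the middle marginals makes them literally equal, and then they glue.
    Lift-trans : ∀ {μ ν ξ} → Lift R₁ μ ν → Lift R₂ ν ξ → Lift R₃ μ ξ
    Lift-trans (c₁ , l₁ , r₁) (c₂ , l₂ , r₂) with ≈M⇒common-refinement (≈trans (≈sym r₁) l₂)
    ... | ν' , c₁◁ν' , c₂◁ν' with ◁-push⁻ (mapF outr) c₁◁ν' | ◁-push⁻ (mapF outl) c₂◁ν'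
    ... | c₁' , c₁◁c₁' , c₁'≡ν' | c₂' , c₂◁c₂' , c₂'≡ν'
      with glue-couplings c₁' c₂' (trans c₁'≡ν' (sym c₂'≡ν'))
    ... | c , c≡ˡ , c≡ʳ =
      c , ≈trans l₁ (≈trans (≈sym (push-cong (mapF outl) (◁⇒≈M c₁◁c₁'))) (≡⇒≈M (sym c≡ˡ))) ,
          ≈trans r₂ (≈trans (≈sym (push-cong (mapF outr) (◁⇒≈M c₂◁c₂'))) (≡⇒≈M (sym c≡ʳ)))

  continue : ∀ {X Y} → M (F Y) → (X → Y) → F X → M (F Y)
  continue D φ ✓ = D
  continue D φ ✗ = δ ✗
  continue D φ (out o) = δ (out o)
  continue D φ (step p x) = δ (step p (φ x))

  module _ {X X' Y Y' : Set} {R : X → Y → Set} {R' : X' → Y' → Set}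
    (φ : X → X') (ψ : Y → Y') (respects : ∀ {x y} → R x y → R' (φ x) (ψ y)) where

    Lift-continue : ∀ {μ ν D E} → Lift R μ ν → Lift R' D E →
      Lift R' (bindM μ (continue D φ)) (bindM ν (continue E ψ))
    Lift-continue {μ} {ν} {D} {E} (c , l , r) (d , dl , dr) = bindM c κ ,
      ≈trans (bind-cong _ l) (≈trans (≡⇒≈M (bind-push _ c _))
        (≈trans (bind-congʳ c κ-outl) (≡⇒≈M (sym (push-bind _ c κ))))) ,
      ≈trans (bind-cong _ r) (≈trans (≡⇒≈M (bind-push _ c _))
        (≈trans (bind-congʳ c κ-outr) (≡⇒≈M (sym (push-bind _ c κ)))))
      where
      κ : F (Graph R) → M (F (Graph R'))
      κ ✓ = d
      κ ✗ = δ ✗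
      κ (out o) = δ (out o)
      κ (step p ((x , y) , xRy)) = δ (step p ((φ x , ψ y) , respects xRy))
      κ-outl : ∀ g → continue D φ (mapF outl g) ≈M pushM (mapF outl) (κ g)
      κ-outl ✓ = dl
      κ-outl ✗ = ≈refl
      κ-outl (out _) = ≈refl
      κ-outl (step _ _) = ≈refl
      κ-outr : ∀ g → continue E ψ (mapF outr g) ≈M pushM (mapF outr) (κ g)
      κ-outr ✓ = dr
      κ-outr ✗ = ≈refl
      κ-outr (out _) = ≈refl
      κ-outr (step _ _) = ≈refl

  module _ {X Y Z : Set} where
    continue-bind : ∀ (D : M (F Y)) (D' : M (F Z)) (φ : X → Y) (ψ : Y → Z) x →
      bindM (continue D φ x) (continue D' ψ) ≈M continue (bindM D (continue D' ψ)) (ψ ∘ φ) x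
    continue-bind D D' φ ψ ✓ = ≈refl
    continue-bind D D' φ ψ ✗ = δ-bind ✗ (continue D' ψ)
    continue-bind D D' φ ψ (out o) = δ-bind (out o) (continue D' ψ)
    continue-bind D D' φ ψ (step p x) = δ-bind (step p (φ x)) (continue D' ψ)

    bind-continue-assoc : ∀ (μ : M (F X)) (D : M (F Y)) (D' : M (F Z)) (φ : X → Y) (ψ : Y → Z) →
      bindM (bindM μ (continue D φ)) (continue D' ψ) ≈M
        bindM μ (continue (bindM D (continue D' ψ)) (ψ ∘ φ))
    bind-continue-assoc μ D D' φ ψ =
      ≈trans (≡⇒≈M (bind-assoc μ _ _)) (bind-congʳ μ (continue-bind D D' φ ψ))

  module _ {X Y : Set} where
    bind-continue-split : ∀ (D : M (F Y)) (φ : X → Y) μ →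
      bindM μ (continue D φ) ≈M scale (coef✓ μ) D ++ bindM μ (continue [] φ)
    bind-continue-split D φ [] = ≈sym (++-congʳ [] (scale-0 D))
    bind-continue-split D φ ((✓ , w) ∷ μ) =
      ≈trans (++-congˡ (scale w D) (bind-continue-split D φ μ))
        (≈trans (≡⇒≈M (sym (List.++-assoc (scale w D) _ _))) (++-congʳ _ (scale-+ w (coef✓ μ) D)))
    bind-continue-split D φ ((✗ , w) ∷ μ) = ++-shift (scale w (δ ✗)) (bind-continue-split D φ μ)
    bind-continue-split D φ ((out o , w) ∷ μ) =
      ++-shift (scale w (δ (out o))) (bind-continue-split D φ μ)
    bind-continue-split D φ ((step p x , w) ∷ μ) =
      ++-shift (scale w (δ (step p (φ x)))) (bind-continue-split D φ μ)

    coef-continue-[] : ∀ (φ : X → Y) μ → coef✓ (bindM μ (continue [] φ)) ≡ 0#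
    coef-continue-[] φ [] = refl
    coef-continue-[] φ ((✓ , _) ∷ μ) = coef-continue-[] φ μ
    coef-continue-[] φ ((✗ , _) ∷ μ) = coef-continue-[] φ μ
    coef-continue-[] φ ((out _ , _) ∷ μ) = coef-continue-[] φ μ
    coef-continue-[] φ ((step _ _ , _) ∷ μ) = coef-continue-[] φ μ

  bind-continue-✓ : ∀ {X} (μ : M (F X)) → bindM μ (continue (δ ✓) id) ≡ μ
  bind-continue-✓ μ = trans (bind-ext μ continue-δ) (trans (bind-δ μ (mapF id)) (push-mapF-id μ))
    where
    continue-δ : ∀ x → continue (δ ✓) id x ≡ δ (mapF id x)
    continue-δ ✓ = refl
    continue-δ ✗ = refl
    continue-δ (out _) = refl
    continue-δ (step _ _) = refl

  -- The operational semantics through continuations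

  residual : Exp → M (F Exp) → M (F Exp)
  residual g μ = bindM μ (continue [] (_⨾ g))

  ∂-⨾ : ∀ e f α → ∂ (e ⨾ f) α ≡ bindM (∂ e α) (continue (∂ f α) (_⨾ f))
  ∂-⨾ e f α = bind-ext (∂ e α) seqCont≗continue
    where
    seqCont≗continue : ∀ x → seqCont f (∂ f α) x ≡ continue (∂ f α) (_⨾ f) x
    seqCont≗continue ✓ = refl
    seqCont≗continue ✗ = refl
    seqCont≗continue (out _) = refl
    seqCont≗continue (step _ _) = refl

  loop-body≡residual : ∀ g μ →
    concatMap (λ p → loopCont g (proj₁ p) (proj₂ p)) μ ≡ residual g μ
  loop-body≡residual g = List.concatMap-cong loopCont≗continue
    where
    loopCont≗continue : ∀ (p : F Exp × S) →
      loopCont g (proj₁ p) (proj₂ p) ≡ scale (proj₂ p) (continue [] (_⨾ g) (proj₁ p))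
    loopCont≗continue (✓ , w) = refl
    loopCont≗continue (✗ , w) = cong (λ v → (✗ , v) ∷ []) (sym (*-identityʳ w))
    loopCont≗continue (out o , w) = cong (λ v → (out o , v) ∷ []) (sym (*-identityʳ w))
    loopCont≗continue (step p x , w) = cong (λ v → (step p (x ⨾ g) , v) ∷ []) (sym (*-identityʳ w))

  by-cases : ∀ {P : Set} (t : Bool) → (t ≡ true → P) → (t ≡ false → P) → P
  by-cases true if-true _ = if-true refl
  by-cases false _ if-false = if-false refl

  module _ {α : At} where
    ∂-loop-true : ∀ e b → ⟦ b ⟧ α ≡ true →
      ∂ (e ⁽ b ⁾) α ≡ scale (coef✓ (∂ e α) ⋆) (residual (e ⁽ b ⁾) (∂ e α))
    ∂-loop-true e b b≡true rewrite b≡true = cong (scale _) (loop-body≡residual (e ⁽ b ⁾) (∂ e α))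

    ∂-loop-false : ∀ e b → ⟦ b ⟧ α ≡ false → ∂ (e ⁽ b ⁾) α ≡ δ ✓
    ∂-loop-false e b b≡false rewrite b≡false = refl

    ∂-ite-true : ∀ e b f → ⟦ b ⟧ α ≡ true → ∂ (e +⟨ b ⟩ f) α ≡ ∂ e α
    ∂-ite-true e b f b≡true rewrite b≡true = refl

    ∂-ite-false : ∀ e b f → ⟦ b ⟧ α ≡ false → ∂ (e +⟨ b ⟩ f) α ≡ ∂ f α
    ∂-ite-false e b f b≡false rewrite b≡false = refl

    ∂-assert-true : ∀ b e → ⟦ b ⟧ α ≡ true → ∂ (assert b ⨾ e) α ≈M ∂ e α
    ∂-assert-true b e b≡true rewrite b≡true = δ-bind ✓ (seqCont e (∂ e α))

    ∂-assert-false : ∀ b e → ⟦ b ⟧ α ≡ false → ∂ (assert b ⨾ e) α ≈M δ ✗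
    ∂-assert-false b e b≡false rewrite b≡false = δ-bind ✗ (seqCont e (∂ e α))

  ∂-⊙ : ∀ r α → ∂ (⊙ r) α ≈M (✓ , r) ∷ []
  ∂-⊙ r α =
    ≈trans (≈cons (≈zero′ (zeroˡ 1#))) (≡⇒≈M (cong (λ w → (✓ , w) ∷ []) (*-identityʳ r)))

  ∂-⊙-⨾ : ∀ r e α → ∂ (⊙ r ⨾ e) α ≈M scale r (∂ e α)
  ∂-⊙-⨾ r e α =
    ≈trans (++-congˡ (scale (r · 1#) (∂ e α)) (≈zero′ (trans (*-identityʳ _) (zeroˡ 1#))))
      (≡⇒≈M (trans (List.++-identityʳ _) (cong (λ w → scale w (∂ e α)) (*-identityʳ r))))

  coef-∂ : ∀ e α → coef✓ (∂ e α) ≡ E e α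
  coef-∂ (act p) α = refl
  coef-∂ (assert b) α with ⟦ b ⟧ α
  ... | true = +-identityʳ 1#
  ... | false = refl
  coef-∂ (e +⟨ b ⟩ f) α with ⟦ b ⟧ α
  ... | true = coef-∂ e α
  ... | false = coef-∂ f α
  coef-∂ (e ⨾ f) α = begin
    coef✓ (∂ (e ⨾ f) α)
      ≡⟨ cong coef✓ (∂-⨾ e f α) ⟩
    coef✓ (bindM (∂ e α) (continue (∂ f α) (_⨾ f)))
      ≡⟨ coef-cong (bind-continue-split (∂ f α) (_⨾ f) (∂ e α)) ⟩
    coef✓ (scale (coef✓ (∂ e α)) (∂ f α) ++ residual f (∂ e α))
      ≡⟨ coef-++ (scale (coef✓ (∂ e α)) (∂ f α)) _ ⟩
    coef✓ (scale (coef✓ (∂ e α)) (∂ f α)) + coef✓ (residual f (∂ e α))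
      ≡⟨ cong₂ _+_ (coef-scale _ (∂ f α)) (coef-continue-[] (_⨾ f) (∂ e α)) ⟩
    coef✓ (∂ e α) · coef✓ (∂ f α) + 0#
      ≡⟨ +-identityʳ _ ⟩
    coef✓ (∂ e α) · coef✓ (∂ f α)
      ≡⟨ cong₂ _·_ (coef-∂ e α) (coef-∂ f α) ⟩
    E e α · E f α ∎
  coef-∂ (e ⁽ b ⁾) α with ⟦ b ⟧ α
  ... | true = begin
    coef✓ (scale (coef✓ (∂ e α) ⋆) body)
      ≡⟨ coef-scale _ body ⟩
    coef✓ (∂ e α) ⋆ · coef✓ body
      ≡⟨ cong (λ μ → coef✓ (∂ e α) ⋆ · coef✓ μ) (loop-body≡residual (e ⁽ b ⁾) (∂ e α)) ⟩
    coef✓ (∂ e α) ⋆ · coef✓ (residual (e ⁽ b ⁾) (∂ e α))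
      ≡⟨ cong (coef✓ (∂ e α) ⋆ ·_) (coef-continue-[] _ (∂ e α)) ⟩
    coef✓ (∂ e α) ⋆ · 0#
      ≡⟨ zeroʳ _ ⟩
    0# ∎
    where body = concatMap (λ p → loopCont (e ⁽ b ⁾) (proj₁ p) (proj₂ p)) (∂ e α)
  ... | false = +-identityʳ 1#
  coef-∂ (ret v) α = refl
  coef-∂ (e ⊕⟨ r , s ⟩ f) α = begin
    coef✓ (scale r (∂ e α) ++ scale s (∂ f α))
      ≡⟨ coef-++ (scale r (∂ e α)) _ ⟩
    coef✓ (scale r (∂ e α)) + coef✓ (scale s (∂ f α))
      ≡⟨ cong₂ _+_ (coef-scale r (∂ e α)) (coef-scale s (∂ f α)) ⟩
    r · coef✓ (∂ e α) + s · coef✓ (∂ f α)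
      ≡⟨ cong₂ (λ x y → r · x + s · y) (coef-∂ e α) (coef-∂ f α) ⟩
    r · E e α + s · E f α ∎

  infix 4 _≋_
  _≋_ : M (F Exp) → M (F Exp) → Set
  _≋_ = Lift _≡ₑ_

  ≋-refl : ∀ μ → μ ≋ μ
  ≋-refl = Lift-refl (λ _ → ≡refl)

  ≈M⇒≋ : ∀ {μ ν} → μ ≈M ν → μ ≋ ν
  ≈M⇒≋ μ≈ν = Lift-≈ˡ μ≈ν (≋-refl _)

  ≡⇒≋ : ∀ {μ ν} → μ ≡ ν → μ ≋ ν
  ≡⇒≋ refl = ≋-refl _

  ≋-continue : ∀ {f f' μ ν D D'} → f ≡ₑ f' → μ ≋ ν → D ≋ D' →
    bindM μ (continue D (_⨾ f)) ≋ bindM ν (continue D' (_⨾ f'))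
  ≋-continue f≡f' = Lift-continue (_⨾ _) (_⨾ _) (λ e≡e' → cong-seq e≡e' f≡f')

  ∂-loop-≋ : ∀ {e e' b c} α → ⟦ b ⟧ α ≡ ⟦ c ⟧ α → e ⁽ b ⁾ ≡ₑ e' ⁽ c ⁾ → ∂ e α ≋ ∂ e' α →
    ∂ (e ⁽ b ⁾) α ≋ ∂ (e' ⁽ c ⁾) α
  ∂-loop-≋ {e} {e'} {b} {c} α b≡c loop≡ ∂e≋∂e' = by-cases (⟦ b ⟧ α)
    (λ b≡true →
      Lift-≈ˡ (≡⇒≈M (∂-loop-true e b b≡true))
        (Lift-≈ʳ (≡⇒≈M (∂-loop-true e' c (trans (sym b≡c) b≡true)))
          (subst (λ x → scale (coef✓ (∂ e α) ⋆) _ ≋ scale (x ⋆) _) (Lift-coef ∂e≋∂e')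
            (Lift-scale _ (≋-continue loop≡ ∂e≋∂e' (≋-refl []))))))
    (λ b≡false →
      ≡⇒≋ (trans (∂-loop-false e b b≡false) (sym (∂-loop-false e' c (trans (sym b≡c) b≡false)))))

  ∂-unfold-loop : ∀ e b {α} → ⟦ b ⟧ α ≡ true → ∂ (e ⨾ e ⁽ b ⁾) α ≈M ∂ (e ⁽ b ⁾) α
  ∂-unfold-loop e b {α} b≡true =
    ≈trans (≡⇒≈M (∂-⨾ e (e ⁽ b ⁾) α))
      (≈trans (bind-continue-split (∂ (e ⁽ b ⁾) α) _ (∂ e α))
        (≈trans (≡⇒≈M (cong (λ μ → scale c μ ++ L) (∂-loop-true e b b≡true)))
          (≈trans (⋆-scale-unfold c L) (≡⇒≈M (sym (∂-loop-true e b b≡true))))))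
    where
    c = coef✓ (∂ e α)
    L = residual (e ⁽ b ⁾) (∂ e α)

  -- Here coef✓ (∂ e α) = s + r k, and the Conway identity (s + r k)⋆ = s⋆ + s⋆ r k (s + r k)⋆
  -- splits the loop into the ⊙ (s⋆ r) branch and a copy of itself.
  L2-sound-true : ∀ {e f b r s α} → ⟦ b ⟧ α ≡ true →
    ∂ e α ≋ scale r (∂ f α) ++ scale s (δ ✓) → ∂ (e ⁽ b ⁾) α ≋ ∂ (⊙ (s ⋆ · r) ⨾ (f ⨾ e ⁽ b ⁾)) α
  L2-sound-true {e} {f} {b} {r} {s} {α} b≡true ∂e≋ =
    Lift-≈ˡ lhs (Lift-≈ʳ rhs (Lift-++ residuals (≋-refl (scale (t · X) Le))))
    where
    k = coef✓ (∂ f α)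
    X = coef✓ (∂ e α) ⋆
    t = (s ⋆ · r) · k
    Le = residual (e ⁽ b ⁾) (∂ e α)
    Lf = residual (e ⁽ b ⁾) (∂ f α)

    coef-e : coef✓ (∂ e α) ≡ s + r · k
    coef-e = begin
      coef✓ (∂ e α)                             ≡⟨ Lift-coef ∂e≋ ⟩
      coef✓ (scale r (∂ f α) ++ scale s (δ ✓))  ≡⟨ coef-++ (scale r (∂ f α)) _ ⟩
      coef✓ (scale r (∂ f α)) + (s · 1# + 0#)   ≡⟨ cong₂ _+_ (coef-scale r (∂ f α)) (+-identityʳ _) ⟩
      r · k + s · 1#                            ≡⟨ cong (r · k +_) (*-identityʳ s) ⟩
      r · k + s                                 ≡⟨ +-comm _ s ⟩
      s + r · k                                 ∎

    X-unfold : X ≡ s ⋆ + t · X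
    X-unfold = begin
      X                        ≡⟨ cong _⋆ coef-e ⟩
      (s + r · k) ⋆            ≡⟨ ⋆-sum-unfold s r k ⟩
      s ⋆ + t · (s + r · k) ⋆  ≡⟨ cong (λ x → s ⋆ + t · x ⋆) coef-e ⟨
      s ⋆ + t · X              ∎

    lhs : ∂ (e ⁽ b ⁾) α ≈M scale (s ⋆) Le ++ scale (t · X) Le
    lhs = ≈trans (≡⇒≈M (trans (∂-loop-true e b b≡true) (cong (λ x → scale x Le) X-unfold)))
            (≈sym (scale-+ (s ⋆) (t · X) Le))

    ∂f-then-loop : ∂ (f ⨾ e ⁽ b ⁾) α ≈M scale (k · X) Le ++ Lf
    ∂f-then-loop =
      ≈trans (≡⇒≈M (∂-⨾ f (e ⁽ b ⁾) α))
        (≈trans (bind-continue-split (∂ (e ⁽ b ⁾) α) _ (∂ f α))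
          (≡⇒≈M (cong (_++ Lf)
            (trans (cong (scale k) (∂-loop-true e b b≡true)) (scale-scale k X Le)))))

    rhs : ∂ (⊙ (s ⋆ · r) ⨾ (f ⨾ e ⁽ b ⁾)) α ≈M scale (s ⋆ · r) Lf ++ scale (t · X) Le
    rhs =
      ≈trans (∂-⊙-⨾ (s ⋆ · r) (f ⨾ e ⁽ b ⁾) α)
        (≈trans (scale-cong (s ⋆ · r) ∂f-then-loop)
          (≈trans (≡⇒≈M (trans (scale-++ (s ⋆ · r) (scale (k · X) Le) Lf)
                          (cong (_++ scale (s ⋆ · r) Lf)
                            (trans (scale-scale (s ⋆ · r) (k · X) Le)
                              (cong (λ x → scale x Le) (sym (*-assoc (s ⋆ · r) k X)))))))
            (++-comm-≈M (scale (t · X) Le) (scale (s ⋆ · r) Lf))))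

    residuals : scale (s ⋆) Le ≋ scale (s ⋆ · r) Lf
    residuals =
      Lift-≈ʳ (≡⇒≈M (sym (trans (cong (scale (s ⋆)) drop-✓) (scale-scale (s ⋆) r Lf))))
        (Lift-scale (s ⋆) (≋-continue ≡refl ∂e≋ (≋-refl [])))
      where
      drop-✓ : residual (e ⁽ b ⁾) (scale r (∂ f α) ++ scale s (δ ✓)) ≡ scale r Lf
      drop-✓ = trans (bind-++ (scale r (∂ f α)) (scale s (δ ✓)) _)
                 (trans (cong (_++ []) (bind-scale r (∂ f α) _)) (List.++-identityʳ _))

  L2-sound : ∀ {e f g b c r s} α → ∂ e α ≋ ∂ ((f ⊕⟨ r , s ⟩ assert 𝟏) +⟨ c ⟩ g) α →
    ∂ (assert c ⨾ e ⁽ b ⁾) α ≋ ∂ (assert c ⨾ ((⊙ (s ⋆ · r) ⨾ (f ⨾ e ⁽ b ⁾)) +⟨ b ⟩ assert 𝟏)) α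
  L2-sound {e} {f} {g} {b} {c} {r} {s} α ∂e≋ = by-cases (⟦ c ⟧ α)
    (λ c≡true →
      Lift-≈ˡ (∂-assert-true c _ c≡true) (Lift-≈ʳ (∂-assert-true c _ c≡true) (by-cases (⟦ b ⟧ α)
        (λ b≡true → Lift-≈ʳ (≡⇒≈M (∂-ite-true W b (assert 𝟏) b≡true))
          (L2-sound-true {e} {f} {b} {r} {s} {α} b≡true
            (Lift-≈ʳ (≡⇒≈M (sym (∂-ite-true (f ⊕⟨ r , s ⟩ assert 𝟏) c g c≡true))) ∂e≋)))
        (λ b≡false →
          ≡⇒≋ (trans (∂-loop-false e b b≡false) (sym (∂-ite-false W b (assert 𝟏) b≡false)))))))
    (λ c≡false → ≈M⇒≋ (≈trans (∂-assert-false c _ c≡false) (≈sym (∂-assert-false c _ c≡false))))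
    where W = ⊙ (s ⋆ · r) ⨾ (f ⨾ e ⁽ b ⁾)

  -- Rule F1: without ✓-mass in ∂ e the loop prefactor is 0⋆ = 1, so both sides
  -- step exactly as ∂ e does, with continuations related by the premise.
  F1-sound : ∀ {e f g b} → g ≡ₑ e ⁽ b ⁾ ⨾ f → (∀ α → E e α ≡ 0#) → ∀ α →
    ∂ ((e ⨾ g) +⟨ b ⟩ f) α ≋ ∂ (e ⁽ b ⁾ ⨾ f) α
  F1-sound {e} {f} {g} {b} g≡ E≡0 α = by-cases (⟦ b ⟧ α)
    (λ b≡true → Lift-≈ˡ (lhs b≡true) (Lift-≈ʳ (rhs b≡true)
      (Lift-continue (_⨾ g) (λ x → (x ⨾ e ⁽ b ⁾) ⨾ f)
        (λ x≡y → ≡trans (cong-seq x≡y g≡) (≡sym S2)) (≋-refl (∂ e α)) (≋-refl []))))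
    (λ b≡false → Lift-≈ˡ (≡⇒≈M (∂-ite-false (e ⨾ g) b f b≡false))
      (Lift-≈ʳ (≈trans (≡⇒≈M (cong (λ μ → bindM μ (seqCont f (∂ f α))) (∂-loop-false e b b≡false)))
                 (δ-bind ✓ (seqCont f (∂ f α))))
        (≋-refl (∂ f α))))
    where
    no-✓ : coef✓ (∂ e α) ≡ 0#
    no-✓ = trans (coef-∂ e α) (E≡0 α)

    lhs : ⟦ b ⟧ α ≡ true → ∂ ((e ⨾ g) +⟨ b ⟩ f) α ≈M residual g (∂ e α)
    lhs b≡true =
      ≈trans (≡⇒≈M (trans (∂-ite-true (e ⨾ g) b f b≡true) (∂-⨾ e g α)))
        (≈trans (bind-continue-split (∂ g α) (_⨾ g) (∂ e α))
          (++-congʳ _ (≈trans (≡⇒≈M (cong (λ w → scale w (∂ g α)) no-✓)) (scale-0 _))))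

    loop-prefactor : ⟦ b ⟧ α ≡ true → ∂ (e ⁽ b ⁾) α ≡ residual (e ⁽ b ⁾) (∂ e α)
    loop-prefactor b≡true = begin
      ∂ (e ⁽ b ⁾) α              ≡⟨ ∂-loop-true e b b≡true ⟩
      scale (coef✓ (∂ e α) ⋆) L  ≡⟨ cong (λ x → scale (x ⋆) L) no-✓ ⟩
      scale (0# ⋆) L             ≡⟨ cong (λ x → scale x L) 0⋆≡1 ⟩
      scale 1# L                 ≡⟨ scale-1 L ⟩
      L                          ∎
      where L = residual (e ⁽ b ⁾) (∂ e α)

    rhs : ⟦ b ⟧ α ≡ true →
      ∂ (e ⁽ b ⁾ ⨾ f) α ≈M bindM (∂ e α) (continue [] (λ x → (x ⨾ e ⁽ b ⁾) ⨾ f))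
    rhs b≡true =
      ≈trans (≡⇒≈M (trans (∂-⨾ (e ⁽ b ⁾) f α)
                      (cong (λ μ → bindM μ (continue (∂ f α) (_⨾ f))) (loop-prefactor b≡true))))
        (bind-continue-assoc (∂ e α) [] (∂ f α) (_⨾ e ⁽ b ⁾) (_⨾ f))

  ≡ₑ⇒≋ : ∀ {e f} → e ≡ₑ f → ∀ α → ∂ e α ≋ ∂ f α
  ≡ₑ⇒≋ ≡refl α = ≋-refl _
  ≡ₑ⇒≋ (≡sym d) α = Lift-sym ≡sym (≡ₑ⇒≋ d α)
  ≡ₑ⇒≋ (≡trans d d') α = Lift-trans ≡trans (≡ₑ⇒≋ d α) (≡ₑ⇒≋ d' α)
  ≡ₑ⇒≋ (cong-ite {b = b} d d') α with ⟦ b ⟧ α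
  ... | true = ≡ₑ⇒≋ d α
  ... | false = ≡ₑ⇒≋ d' α
  ≡ₑ⇒≋ (cong-seq {e} {e'} {f} {f'} d d') α =
    Lift-≈ˡ (≡⇒≈M (∂-⨾ e f α))
      (Lift-≈ʳ (≡⇒≈M (∂-⨾ e' f' α)) (≋-continue d' (≡ₑ⇒≋ d α) (≡ₑ⇒≋ d' α)))
  ≡ₑ⇒≋ (cong-loop {e} {e'} {b} d) α = ∂-loop-≋ {e} {e'} {b} {b} α refl (cong-loop d) (≡ₑ⇒≋ d α)
  ≡ₑ⇒≋ (cong-⊕ {r = r} {s = s} d d') α =
    Lift-++ (Lift-scale r (≡ₑ⇒≋ d α)) (Lift-scale s (≡ₑ⇒≋ d' α))
  ≡ₑ⇒≋ (BA-test b≡c) α rewrite b≡c α = ≋-refl _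
  ≡ₑ⇒≋ (BA-ite b≡c) α rewrite b≡c α = ≋-refl _
  ≡ₑ⇒≋ (BA-loop {e} {b} {c} b≡c) α =
    ∂-loop-≋ {e} {e} {b} {c} α (b≡c α) (BA-loop b≡c) (≋-refl (∂ e α))
  ≡ₑ⇒≋ (G1 {b = b}) α with ⟦ b ⟧ α
  ... | true = ≋-refl _
  ... | false = ≋-refl _
  ≡ₑ⇒≋ (G2 {e} {b = b}) α with ⟦ b ⟧ α
  ... | true = ≈M⇒≋ (≈sym (δ-bind ✓ (seqCont e (∂ e α))))
  ... | false = ≋-refl _
  ≡ₑ⇒≋ (G3 {b = b}) α with ⟦ b ⟧ α
  ... | true = ≋-refl _
  ... | false = ≋-refl _
  ≡ₑ⇒≋ (G4 {b = b} {c = c}) α with ⟦ b ⟧ α | ⟦ c ⟧ α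
  ... | true | true = ≋-refl _
  ... | true | false = ≋-refl _
  ... | false | true = ≋-refl _
  ... | false | false = ≋-refl _
  ≡ₑ⇒≋ (D1 {b = b}) α with ⟦ b ⟧ α
  ... | true = ≋-refl _
  ... | false = ≋-refl _
  ≡ₑ⇒≋ (D2 {e} {f} {g} {r} {s} {t} {u}) α = ≡⇒≋ (cong (scale r (∂ e α) ++_)
    (trans (scale-scale-++ s t u (∂ f α) (∂ g α)) (sym (scale-1 _))))
  ≡ₑ⇒≋ (D3 {e} {f} {b} {r} {s}) α = by-cases (⟦ b ⟧ α)
    (λ b≡true → ≈M⇒≋ (≈trans (∂-assert-true b _ b≡true) (≈sym (≈trans (∂-assert-true b _ b≡true)
      (++-cong (scale-cong r (∂-assert-true b e b≡true))
               (scale-cong s (∂-assert-true b f b≡true)))))))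
    (λ b≡false → ≈M⇒≋ (≈trans (∂-assert-false b _ b≡false) (≈sym (∂-assert-false b _ b≡false))))
  ≡ₑ⇒≋ (S1l {e}) α = ≈M⇒≋ (δ-bind ✓ (seqCont e (∂ e α)))
  ≡ₑ⇒≋ (S1r {e}) α =
    Lift-≈ˡ (≡⇒≈M (sym (bind-continue-✓ (∂ e α)))) (Lift-≈ʳ (≡⇒≈M (∂-⨾ e (assert 𝟏) α))
      (Lift-continue id (_⨾ assert 𝟏) (λ x≡y → ≡trans x≡y S1r)
        (≋-refl (∂ e α)) (≋-refl (δ ✓))))
  ≡ₑ⇒≋ (S2 {e} {f} {g}) α =
    Lift-≈ˡ (≈trans (≡⇒≈M (trans (∂-⨾ (e ⨾ f) g α)
                              (cong (λ μ → bindM μ (continue (∂ g α) (_⨾ g))) (∂-⨾ e f α))))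
               (bind-continue-assoc (∂ e α) (∂ f α) (∂ g α) (_⨾ f) (_⨾ g)))
      (Lift-≈ʳ (≡⇒≈M (∂-⨾ e (f ⨾ g) α))
        (Lift-continue (λ x → (x ⨾ f) ⨾ g) (_⨾ (f ⨾ g))
          (λ x≡y → ≡trans (cong-seq (cong-seq x≡y ≡refl) ≡refl) S2)
          (≋-refl (∂ e α)) (≡⇒≋ (sym (∂-⨾ f g α)))))
  ≡ₑ⇒≋ (S3 {e}) α = ≈M⇒≋ (δ-bind ✗ (seqCont e (∂ e α)))
  ≡ₑ⇒≋ (S4 {e} {f} {g} {r} {s}) α = ≡⇒≋
    (trans (bind-++ (scale r (∂ e α)) (scale s (∂ f α)) k)
      (cong₂ _++_ (bind-scale r (∂ e α) k) (bind-scale s (∂ f α) k)))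
    where k = seqCont g (∂ g α)
  ≡ₑ⇒≋ (S5 {b = b}) α with ⟦ b ⟧ α
  ... | true = ≋-refl _
  ... | false = ≋-refl _
  ≡ₑ⇒≋ (S6 {v} {e}) α = ≈M⇒≋ (δ-bind (out v) (seqCont e (∂ e α)))
  ≡ₑ⇒≋ (S7 {b} {c}) α with ⟦ b ⟧ α | ⟦ c ⟧ α
  ... | true | true = ≈M⇒≋ (δ-bind ✓ (seqCont (assert c) (δ ✓)))
  ... | true | false = ≈M⇒≋ (δ-bind ✓ (seqCont (assert c) (δ ✗)))
  ... | false | true = ≈M⇒≋ (δ-bind ✗ (seqCont (assert c) (δ ✓)))
  ... | false | false = ≈M⇒≋ (δ-bind ✗ (seqCont (assert c) (δ ✗)))
  ≡ₑ⇒≋ (L1 {e} {b}) α = by-cases (⟦ b ⟧ α)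
    (λ b≡true → Lift-≈ʳ (≡⇒≈M (∂-ite-true (e ⨾ e ⁽ b ⁾) b (assert 𝟏) b≡true))
      (≈M⇒≋ (≈sym (∂-unfold-loop e b b≡true))))
    (λ b≡false →
      ≡⇒≋ (trans (∂-loop-false e b b≡false) (sym (∂-ite-false (e ⨾ e ⁽ b ⁾) b (assert 𝟏) b≡false))))
  ≡ₑ⇒≋ C1 α = ≈M⇒≋ (∂-⊙ 1# α)
  ≡ₑ⇒≋ (C2 {e}) α =
    ≈M⇒≋ (≈trans (∂-⊙-⨾ 0# e α) (≈trans (scale-0 (∂ e α)) (≈sym (≈trans (∂-⊙ 0# α) ≈zero))))
  ≡ₑ⇒≋ (W1 {e} {r} {s}) α = ≈M⇒≋ (≈trans (scale-+ r s (∂ e α)) (≈sym (∂-⊙-⨾ (r + s) e α)))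
  ≡ₑ⇒≋ (W2 {e} {f} {r} {s}) α = ≈M⇒≋ (++-comm-≈M (scale r (∂ e α)) (scale s (∂ f α)))
  ≡ₑ⇒≋ (W3 {e} {f} {g} {r} {s} {t} {u}) α = ≡⇒≋ (begin
    scale r (∂ e α) ++ scale s (scale t (∂ f α) ++ scale u (∂ g α))
      ≡⟨ cong (scale r (∂ e α) ++_) (scale-scale-++ s t u (∂ f α) (∂ g α)) ⟩
    scale r (∂ e α) ++ (scale (s · t) (∂ f α) ++ scale (s · u) (∂ g α))
      ≡⟨ List.++-assoc (scale r (∂ e α)) _ _ ⟨
    (scale r (∂ e α) ++ scale (s · t) (∂ f α)) ++ scale (s · u) (∂ g α)
      ≡⟨ cong (_++ scale (s · u) (∂ g α)) (scale-1 _) ⟨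
    scale 1# (scale r (∂ e α) ++ scale (s · t) (∂ f α)) ++ scale (s · u) (∂ g α) ∎)
  ≡ₑ⇒≋ (W4 {e} {f} {r} {s} {u}) α = ≈M⇒≋ (++-congʳ (scale s (∂ f α))
    (≈trans (≡⇒≈M (sym (scale-scale r u (∂ e α)))) (scale-cong r (≈sym (∂-⊙-⨾ u e α)))))
  ≡ₑ⇒≋ (L2 {e} {f} {g} {b} {c} {r} {s} d) α =
    L2-sound {e} {f} {g} {b} {c} {r} {s} α (≡ₑ⇒≋ d α)
  ≡ₑ⇒≋ (F1 d E≡0) α = Lift-trans ≡trans (≡ₑ⇒≋ d α) (F1-sound (F1 d E≡0) E≡0 α)

  ≡ₑ-isBisimulation : IsBisimulation ExpAut ExpAut _≡ₑ_
  ≡ₑ-isBisimulation =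
    (λ z α → proj₁ (≡ₑ⇒≋ (proj₂ z) α)) ,
    (λ z α → proj₁ (proj₂ (≡ₑ⇒≋ (proj₂ z) α))) ,
    (λ z α → proj₂ (proj₂ (≡ₑ⇒≋ (proj₂ z) α)))

mainTheorem1 : (K : ConwaySemiring) (n : ℕ) (Act Out : Set)
    (e f : WGKAT.Exp K n Act Out) →
    WGKAT._≡ₑ_ K n Act Out e f → WGKAT._∼_ K n Act Out e f
mainTheorem1 K n Act Out e f e≡f =
  WGKAT._≡ₑ_ K n Act Out , Soundness.≡ₑ-isBisimulation K n Act Out , e≡f
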